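{- Let $(\mathcal{C},T,C,\succeq)$ be a target–context category and let $(r_1,q_1)\colon s\to s_1$ and $(r_2,q_2)\colon s_1\to s_2$ be simulator morphisms, where $s,s_1,s_2$ have programs $P,P_1,P_2$. Then $r_1\circ r_2\colon P_2\to P$ is a reduction from $s$ to $s\circ((r_1\circ r_2)\otimes\mathrm{id}_C)$ (i.e. it is functional), and $$q':=q_2\circ\bigl(\mathrm{id}_{P_2}\otimes(q_1\circ(r_2\otimes\mathrm{id}_{T\otimes C}))\bigr)\circ(\mathrm{copy}_{P_2}\otimes\mathrm{id}_{T\otimes C})$$ is a processing from $s\circ((r_1\circ r_2)\otimes\mathrm{id}_C)$ to $s_2$. Consequently $(r_1\circ r_2,q')$ is a simulator morphism $s\to s_2$.
   Context: A gs-monoidal category is a symmetric monoidal category (tensor $\otimes$, unit $I$) whose objects carry commutative comonoids $\mathrm{copy}_A\colon A\to A\otimes A$, $\mathrm{del}_A\colon A\to I$ compatible with $\otimes$, with $\mathrm{del}_I=\mathrm{id}_I$. For $f\colon A\to X$: $\mathrm{dom}(f)=(\mathrm{id}_A\otimes(\mathrm{del}_X\circ f))\circ\mathrm{copy}_A$; normalized: $f\circ\mathrm{dom}(f)=f$; functional: $\mathrm{copy}_X\circ f=(f\otimes f)\circ\mathrm{copy}_A$. A target–context category $(\mathcal{C},T,C,\succeq)$ is a gs-monoidal category with all morphisms normalized, objects $T,C$ and a preorder $\succeq$ on each $\mathcal{C}(A,T\otimes C)$ with $f\circ\mathrm{dom}(g)=g\Rightarrow f\succeq g$ and $f\succeq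 g\Rightarrow f\circ h\succeq g\circ h$. A simulator with programs $P$: $s\colon P\otimes C\to T\otimes C$ such that there are a functional $s_T\colon P\to T$ and $s_C\colon P\otimes C\to C$ with $s=(s_T\otimes s_C)\circ(\mathrm{copy}_P\otimes\mathrm{id}_C)$, $(\mathrm{id}_T\otimes\mathrm{del}_C)\circ s=s_T\otimes\mathrm{del}_C$, $(\mathrm{del}_T\otimes\mathrm{id}_C)\circ s=s_C$. For simulators $s,s'$ both with programs $P'$, a processing from $s$ to $s'$ is $q\colon P'\otimes T\otimes C\to T\otimes C$ such that (i) $q$ is a simulator with programs $P'\otimes T$; (ii) $\mathrm{del}_{P'}\otimes\mathrm{id}_{T\otimes C}\succeq q$; (iii) $s'=q\circ(\mathrm{id}_{P'}\otimes s)\circ(\mathrm{copy}_{P'}\otimes\mathrm{id}_C)$. A reduction from a simulator $s$ (programs $P$) to $s\circ(r\otimes\mathrm{id}_C)$ is given by a functional $r\colon P'\to P$. A simulator morphism $(r,q)\colon s\to s'$ (programs $P$, $P'$) is a functional $r\colon P'\to P$ together with a processing $q$ from $s\circ(r\otimes\mathrm{id}_C)$ to $s'$. -}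

module Defs where

open import Level using (Level; _⊔_) renaming (suc to lsuc)
open import Data.Product using (Σ; _×_; _,_)
open import Relation.Binary.Core using (Rel)
open import Relation.Binary.Structures using (IsEquivalence; IsPreorder)

record GSMonoidal (o ℓ e : Level) : Set (lsuc (o ⊔ ℓ ⊔ e)) where
  infixr 9 _∘_
  infixr 10 _⊗₁_
  infixr 10 _⊗₀_
  infix  4 _≈_
  field
    Obj  : Set o
    Hom  : Obj → Obj → Set ℓ
    _≈_  : ∀ {A B} → Rel (Hom A B) e
    ≈-equiv : ∀ {A B} → IsEquivalence (_≈_ {A} {B})
    id   : (A : Obj) → Hom A A
    _∘_  : ∀ {A B C} → Hom B C → Hom A B → Hom A C
    ∘-resp-≈ : ∀ {A B C} {f f' : Hom B C} {g g' : Hom A B} →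
               f ≈ f' → g ≈ g' → f ∘ g ≈ f' ∘ g'
    assoc : ∀ {A B C D} (f : Hom C D) (g : Hom B C) (h : Hom A B) →
            (f ∘ g) ∘ h ≈ f ∘ (g ∘ h)
    identityˡ : ∀ {A B} (f : Hom A B) → id B ∘ f ≈ f
    identityʳ : ∀ {A B} (f : Hom A B) → f ∘ id A ≈ f
    _⊗₀_ : Obj → Obj → Obj
    I    : Obj
    _⊗₁_ : ∀ {A B C D} → Hom A B → Hom C D → Hom (A ⊗₀ C) (B ⊗₀ D)
    ⊗-resp-≈ : ∀ {A B C D} {f f' : Hom A B} {g g' : Hom C D} →
               f ≈ f' → g ≈ g' → f ⊗₁ g ≈ f' ⊗₁ g'
    ⊗-id : (A B : Obj) → id A ⊗₁ id B ≈ id (A ⊗₀ B)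
    ⊗-∘  : ∀ {A B C D E F} (f : Hom B C) (g : Hom A B) (h : Hom E F) (k : Hom D E) →
           (f ∘ g) ⊗₁ (h ∘ k) ≈ (f ⊗₁ h) ∘ (g ⊗₁ k)
    α    : (A B C : Obj) → Hom ((A ⊗₀ B) ⊗₀ C) (A ⊗₀ (B ⊗₀ C))
    α⁻¹  : (A B C : Obj) → Hom (A ⊗₀ (B ⊗₀ C)) ((A ⊗₀ B) ⊗₀ C)
    α-isoˡ : (A B C : Obj) → α⁻¹ A B C ∘ α A B C ≈ id ((A ⊗₀ B) ⊗₀ C)
    α-isoʳ : (A B C : Obj) → α A B C ∘ α⁻¹ A B C ≈ id (A ⊗₀ (B ⊗₀ C))
    α-natural : ∀ {A A' B B' C C'} (f : Hom A A') (g : Hom B B') (h : Hom C C') →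
                α A' B' C' ∘ ((f ⊗₁ g) ⊗₁ h) ≈ (f ⊗₁ (g ⊗₁ h)) ∘ α A B C
    unitˡ   : (A : Obj) → Hom (I ⊗₀ A) A
    unitˡ⁻¹ : (A : Obj) → Hom A (I ⊗₀ A)
    unitˡ-isoˡ : (A : Obj) → unitˡ⁻¹ A ∘ unitˡ A ≈ id (I ⊗₀ A)
    unitˡ-isoʳ : (A : Obj) → unitˡ A ∘ unitˡ⁻¹ A ≈ id A
    unitˡ-natural : ∀ {A B} (f : Hom A B) → unitˡ B ∘ (id I ⊗₁ f) ≈ f ∘ unitˡ A
    unitʳ   : (A : Obj) → Hom (A ⊗₀ I) A
    unitʳ⁻¹ : (A : Obj) → Hom A (A ⊗₀ I)
    unitʳ-isoˡ : (A : Obj) → unitʳ⁻¹ A ∘ unitʳ A ≈ id (A ⊗₀ I)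
    unitʳ-isoʳ : (A : Obj) → unitʳ A ∘ unitʳ⁻¹ A ≈ id A
    unitʳ-natural : ∀ {A B} (f : Hom A B) → unitʳ B ∘ (f ⊗₁ id I) ≈ f ∘ unitʳ A
    σ : (A B : Obj) → Hom (A ⊗₀ B) (B ⊗₀ A)
    σ-natural : ∀ {A A' B B'} (f : Hom A A') (g : Hom B B') →
                σ A' B' ∘ (f ⊗₁ g) ≈ (g ⊗₁ f) ∘ σ A B
    σ-involutive : (A B : Obj) → σ B A ∘ σ A B ≈ id (A ⊗₀ B)
    triangle : (A B : Obj) →
               (id A ⊗₁ unitˡ B) ∘ α A I B ≈ unitʳ A ⊗₁ id B
    pentagon : (A B C D : Obj) →
               (id A ⊗₁ α B C D) ∘ (α A (B ⊗₀ C) D ∘ (α A B C ⊗₁ id D))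
                 ≈ α A B (C ⊗₀ D) ∘ α (A ⊗₀ B) C D
    hexagon : (A B C : Obj) →
              α B C A ∘ (σ A (B ⊗₀ C) ∘ α A B C)
                ≈ (id B ⊗₁ σ A C) ∘ (α B A C ∘ (σ A B ⊗₁ id C))
    copy : (A : Obj) → Hom A (A ⊗₀ A)
    del  : (A : Obj) → Hom A I
    copy-counitˡ : (A : Obj) → (del A ⊗₁ id A) ∘ copy A ≈ unitˡ⁻¹ A
    copy-counitʳ : (A : Obj) → (id A ⊗₁ del A) ∘ copy A ≈ unitʳ⁻¹ A
    copy-coassoc : (A : Obj) →
                   α A A A ∘ ((copy A ⊗₁ id A) ∘ copy A) ≈ (id A ⊗₁ copy A) ∘ copy A
    copy-comm : (A : Obj) → σ A A ∘ copy A ≈ copy A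
    copy-⊗ : (A B : Obj) →
             copy (A ⊗₀ B) ≈
               α⁻¹ A B (A ⊗₀ B)
               ∘ ((id A ⊗₁ (α B A B ∘ ((σ A B ⊗₁ id B) ∘ α⁻¹ A B B)))
               ∘ (α A A (B ⊗₀ B) ∘ (copy A ⊗₁ copy B)))
    del-⊗ : (A B : Obj) → del (A ⊗₀ B) ≈ unitˡ I ∘ (del A ⊗₁ del B)
    del-I : del I ≈ id I

  ≈-refl : ∀ {A B} {f : Hom A B} → f ≈ f
  ≈-refl = IsEquivalence.refl ≈-equiv

  dom : ∀ {A X} → Hom A X → Hom A A
  dom {A} {X} f = unitʳ A ∘ ((id A ⊗₁ (del X ∘ f)) ∘ copy A)

  Normalized : ∀ {A X} → Hom A X → Set e
  Normalized f = f ∘ dom f ≈ f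

  Functional : ∀ {A X} → Hom A X → Set e
  Functional {A} {X} f = copy X ∘ f ≈ (f ⊗₁ f) ∘ copy A

record TargetContext (o ℓ e p : Level) : Set (lsuc (o ⊔ ℓ ⊔ e ⊔ p)) where
  field
    gs : GSMonoidal o ℓ e
  open GSMonoidal gs public
  field
    normalized : ∀ {A X} (f : Hom A X) → Normalized f
    T C : Obj
    _≽_ : ∀ {A} → Rel (Hom A (T ⊗₀ C)) p
    ≽-preorder : ∀ {A} → IsPreorder (_≈_ {A} {T ⊗₀ C}) (_≽_ {A})
    ≽-dom : ∀ {A} (f g : Hom A (T ⊗₀ C)) → f ∘ dom g ≈ g → f ≽ g
    ≽-precomp : ∀ {A B} (f g : Hom A (T ⊗₀ C)) (h : Hom B A) →
                f ≽ g → (f ∘ h) ≽ (g ∘ h)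

module Simulators {o ℓ e p} (𝒞 : TargetContext o ℓ e p) where
  open TargetContext 𝒞 public

  IsSimulator : (P : Obj) → Hom (P ⊗₀ C) (T ⊗₀ C) → Set (ℓ ⊔ e)
  IsSimulator P s =
    Σ (Hom P T) λ sT → Σ (Hom (P ⊗₀ C) C) λ sC →
      Functional sT
      × (s ≈ (sT ⊗₁ sC) ∘ (α P P C ∘ (copy P ⊗₁ id C)))
      × ((id T ⊗₁ del C) ∘ s ≈ sT ⊗₁ del C)
      × (unitˡ C ∘ ((del T ⊗₁ id C) ∘ s) ≈ sC)

  IsProcessing : (P' : Obj) (s s' : Hom (P' ⊗₀ C) (T ⊗₀ C)) →
                 Hom ((P' ⊗₀ T) ⊗₀ C) (T ⊗₀ C) → Set (ℓ ⊔ e ⊔ p)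
  IsProcessing P' s s' q =
    IsSimulator (P' ⊗₀ T) q
    × ((unitˡ (T ⊗₀ C) ∘ ((del P' ⊗₁ id (T ⊗₀ C)) ∘ α P' T C)) ≽ q)
    × (s' ≈ q ∘ (α⁻¹ P' T C ∘ ((id P' ⊗₁ s) ∘ (α P' P' C ∘ (copy P' ⊗₁ id C)))))

  IsReduction : {P P' : Obj} (s : Hom (P ⊗₀ C) (T ⊗₀ C)) (r : Hom P' P) → Set e
  IsReduction s r = Functional r

  IsSimulatorMorphism : (P P' : Obj) (s : Hom (P ⊗₀ C) (T ⊗₀ C))
                        (s' : Hom (P' ⊗₀ C) (T ⊗₀ C))
                        (r : Hom P' P) (q : Hom ((P' ⊗₀ T) ⊗₀ C) (T ⊗₀ C)) →
                        Set (ℓ ⊔ e ⊔ p)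
  IsSimulatorMorphism P P' s s' r q =
    Functional r × IsProcessing P' (s ∘ (r ⊗₁ id C)) s' q

  compProcessing : (P₁ P₂ : Obj) (r₂ : Hom P₂ P₁)
                   (q₁ : Hom ((P₁ ⊗₀ T) ⊗₀ C) (T ⊗₀ C))
                   (q₂ : Hom ((P₂ ⊗₀ T) ⊗₀ C) (T ⊗₀ C)) →
                   Hom ((P₂ ⊗₀ T) ⊗₀ C) (T ⊗₀ C)
  compProcessing P₁ P₂ r₂ q₁ q₂ =
    q₂ ∘ (α⁻¹ P₂ T C
    ∘ ((id P₂ ⊗₁ (q₁ ∘ (α⁻¹ P₁ T C ∘ (r₂ ⊗₁ id (T ⊗₀ C)))))
    ∘ (α P₂ P₂ (T ⊗₀ C) ∘ ((copy P₂ ⊗₁ id (T ⊗₀ C)) ∘ α P₂ T C))))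

-- A simulator with programs P is a fork (a ⊗ c) ∘ α ∘ (copy ⊗ id) of a functional target part a
-- and a context part c. Forks are stable under precomposition with functional maps, and for
-- functional n they compose as fork a c ∘ fork n d ≈ fork (a ∘ n) (c ∘ fork n d), by
-- coassociativity of copy. Since r₂ is functional, the first stage of q′ (feeding the program
-- to q₁ through r₂) is itself a fork, whose target part keeps the program and updates the target
-- by a₁ ∘ (r₂ ⊗ id); so q′ = q₂ ∘ stage₁ is a fork with a functional target part, i.e. a
-- simulator. Substituting the equation for s₁ into the one for s₂ and composing the two forks
-- gives the equation for q′. For the order condition,
--   del_P₂ ≽ del_P₁ ∘ r₂ ≽ q₁ ∘ (r₂ ⊗ id) ≈ del_P₂ ∘ stage₁ ≽ q₂ ∘ stage₁,
-- by the domain axiom, the bounds on q₁ and q₂ precomposed, and because discarding the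
-- program after stage₁ leaves exactly q₁ ∘ (r₂ ⊗ id).
-- The coherence work lies in the functionality of the associator, needed for the duplication
-- P ⊗ X → P ⊗ (P ⊗ X): copy on a tensor is the middle-four interchange of the two copies, and
-- the interchange commutes with α up to a Mac Lane style pentagon/hexagon computation.

module Submission where

open import Defs
open import Level using (Level)
open import Data.Product using (_×_; _,_)
open import Relation.Binary.Bundles using (Setoid)
open import Relation.Binary.Structures using (IsEquivalence; IsPreorder)
import Relation.Binary.Reasoning.Setoid as SetoidReasoning

module Reasoning {o ℓ e : Level} (𝒢 : GSMonoidal o ℓ e) where
  open GSMonoidal 𝒢

  module ≈ {A B} = IsEquivalence (≈-equiv {A} {B})

  hom-setoid : Obj → Obj → Setoid ℓ e
  hom-setoid A B = record { Carrier = Hom A B ; _≈_ = _≈_ ; isEquivalence = ≈-equiv }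

  module HomReasoning {A B} = SetoidReasoning (hom-setoid A B)
  open HomReasoning public

  infixr 4 _⟩∘⟨_ refl⟩∘⟨_ _⟩⊗⟨_
  infixl 5 _⟩∘⟨refl

  _⟩∘⟨_ : ∀ {A B D} {f f' : Hom B D} {g g' : Hom A B} → f ≈ f' → g ≈ g' → f ∘ g ≈ f' ∘ g'
  p ⟩∘⟨ q = ∘-resp-≈ p q

  refl⟩∘⟨_ : ∀ {A B D} {f : Hom B D} {g g' : Hom A B} → g ≈ g' → f ∘ g ≈ f ∘ g'
  refl⟩∘⟨ q = ∘-resp-≈ ≈.refl q

  _⟩∘⟨refl : ∀ {A B D} {f f' : Hom B D} {g : Hom A B} → f ≈ f' → f ∘ g ≈ f' ∘ g
  p ⟩∘⟨refl = ∘-resp-≈ p ≈.refl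

  _⟩⊗⟨_ : ∀ {A B D E} {f f' : Hom A B} {g g' : Hom D E} → f ≈ f' → g ≈ g' → f ⊗₁ g ≈ f' ⊗₁ g'
  p ⟩⊗⟨ q = ⊗-resp-≈ p q

  ι : ∀ {A} → Hom A A
  ι = id _

  α⇒ : ∀ {A B D} → Hom ((A ⊗₀ B) ⊗₀ D) (A ⊗₀ (B ⊗₀ D))
  α⇒ = α _ _ _

  α⇐ : ∀ {A B D} → Hom (A ⊗₀ (B ⊗₀ D)) ((A ⊗₀ B) ⊗₀ D)
  α⇐ = α⁻¹ _ _ _

  λ⇒ : ∀ {A} → Hom (I ⊗₀ A) A
  λ⇒ = unitˡ _

  ρ⇒ : ∀ {A} → Hom (A ⊗₀ I) A
  ρ⇒ = unitʳ _

  σ⇒ : ∀ {A B} → Hom (A ⊗₀ B) (B ⊗₀ A)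
  σ⇒ = σ _ _

  Δ : ∀ {A} → Hom A (A ⊗₀ A)
  Δ = copy _

  sym-assoc : ∀ {A B D E} (f : Hom D E) (g : Hom B D) (h : Hom A B) → f ∘ (g ∘ h) ≈ (f ∘ g) ∘ h
  sym-assoc f g h = ≈.sym (assoc f g h)

  assoc₃ : ∀ {A0 A1 A2 A3 A4} {a : Hom A3 A4} {b : Hom A2 A3} {c : Hom A1 A2} {r : Hom A0 A1} →
           (a ∘ (b ∘ c)) ∘ r ≈ a ∘ (b ∘ (c ∘ r))
  assoc₃ = ≈.trans (assoc _ _ _) (refl⟩∘⟨ assoc _ _ _)

  assoc₅ : ∀ {A0 A1 A2 A3 A4 A5 A6} {a : Hom A5 A6} {b : Hom A4 A5} {c : Hom A3 A4} {d : Hom A2 A3} {f : Hom A1 A2} {r : Hom A0 A1} →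
           (a ∘ (b ∘ (c ∘ (d ∘ f)))) ∘ r ≈ a ∘ (b ∘ (c ∘ (d ∘ (f ∘ r))))
  assoc₅ = ≈.trans (assoc _ _ _) (refl⟩∘⟨ ≈.trans (assoc _ _ _) (refl⟩∘⟨ ≈.trans (assoc _ _ _) (refl⟩∘⟨ assoc _ _ _)))

  pullˡ : ∀ {A B D E} {a : Hom D E} {b : Hom B D} {c : Hom B E} {f : Hom A B} →
          a ∘ b ≈ c → a ∘ (b ∘ f) ≈ c ∘ f
  pullˡ {a = a} {b} {f = f} q = ≈.trans (sym-assoc a b f) (q ⟩∘⟨refl)

  pullʳ : ∀ {A B D E} {a : Hom D E} {b : Hom B D} {c : Hom A B} {d : Hom A D} →
          b ∘ c ≈ d → (a ∘ b) ∘ c ≈ a ∘ d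
  pullʳ {a = a} {b} {c} q = ≈.trans (assoc a b c) (refl⟩∘⟨ q)

  extendˡ : ∀ {A B B' D E} {a : Hom D E} {b : Hom B D} {a' : Hom B' E} {b' : Hom B B'} {f : Hom A B} →
            a ∘ b ≈ a' ∘ b' → a ∘ (b ∘ f) ≈ a' ∘ (b' ∘ f)
  extendˡ q = ≈.trans (pullˡ q) (assoc _ _ _)

  cancelˡ : ∀ {A B D} {a : Hom D B} {b : Hom B D} {f : Hom A B} → a ∘ b ≈ id B → a ∘ (b ∘ f) ≈ f
  cancelˡ q = ≈.trans (pullˡ q) (identityˡ _)

  idˡ : ∀ {A B} {f : Hom A B} → id B ∘ f ≈ f
  idˡ = identityˡ _

  idʳ : ∀ {A B} {f : Hom A B} → f ∘ id A ≈ f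
  idʳ = identityʳ _

  introʳ : ∀ {A B} {f : Hom A B} {g : Hom A A} → g ≈ id A → f ≈ f ∘ g
  introʳ q = ≈.sym (≈.trans (refl⟩∘⟨ q) idʳ)

  split-⊗ : ∀ {A B D E F G} {f : Hom B D} {g : Hom A B} {h : Hom F G} {k : Hom E F} →
        (f ∘ g) ⊗₁ (h ∘ k) ≈ (f ⊗₁ h) ∘ (g ⊗₁ k)
  split-⊗ = ⊗-∘ _ _ _ _

  merge-⊗ : ∀ {A B D E F G} {f : Hom B D} {g : Hom A B} {h : Hom F G} {k : Hom E F} →
        (f ⊗₁ h) ∘ (g ⊗₁ k) ≈ (f ∘ g) ⊗₁ (h ∘ k)
  merge-⊗ = ≈.sym split-⊗

  id⊗id : ∀ {A B} → id A ⊗₁ id B ≈ id (A ⊗₀ B)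
  id⊗id = ⊗-id _ _

  serialize₁₂ : ∀ {A B D E} {f : Hom A B} {g : Hom D E} → f ⊗₁ g ≈ (f ⊗₁ id E) ∘ (id A ⊗₁ g)
  serialize₁₂ = ≈.trans (≈.sym idʳ ⟩⊗⟨ ≈.sym idˡ) split-⊗

  serialize₂₁ : ∀ {A B D E} {f : Hom A B} {g : Hom D E} → f ⊗₁ g ≈ (id B ⊗₁ g) ∘ (f ⊗₁ id D)
  serialize₂₁ = ≈.trans (≈.sym idˡ ⟩⊗⟨ ≈.sym idʳ) split-⊗

  split-⊗ˡ : ∀ {A B D E} {f : Hom B D} {g : Hom A B} → (f ∘ g) ⊗₁ id E ≈ (f ⊗₁ id E) ∘ (g ⊗₁ id E)
  split-⊗ˡ = ≈.trans (≈.refl ⟩⊗⟨ ≈.sym idˡ) split-⊗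

  split-⊗ʳ : ∀ {A B D E} {f : Hom B D} {g : Hom A B} → id E ⊗₁ (f ∘ g) ≈ (id E ⊗₁ f) ∘ (id E ⊗₁ g)
  split-⊗ʳ = ≈.trans (≈.sym idˡ ⟩⊗⟨ ≈.refl) split-⊗

  split-⊗ˡ₅ : ∀ {A0 A1 A2 A3 A4 A5 Z} {a : Hom A4 A5} {b : Hom A3 A4} {c : Hom A2 A3} {d : Hom A1 A2} {f : Hom A0 A1} →
         (a ∘ (b ∘ (c ∘ (d ∘ f)))) ⊗₁ id Z ≈ (a ⊗₁ id Z) ∘ ((b ⊗₁ id Z) ∘ ((c ⊗₁ id Z) ∘ ((d ⊗₁ id Z) ∘ (f ⊗₁ id Z))))
  split-⊗ˡ₅ = ≈.trans split-⊗ˡ (refl⟩∘⟨ ≈.trans split-⊗ˡ (refl⟩∘⟨ ≈.trans split-⊗ˡ (refl⟩∘⟨ split-⊗ˡ)))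

  split-⊗ʳ₃ : ∀ {X A0 A1 A2 A3} {a : Hom A2 A3} {b : Hom A1 A2} {c : Hom A0 A1} →
         id X ⊗₁ (a ∘ (b ∘ c)) ≈ (id X ⊗₁ a) ∘ ((id X ⊗₁ b) ∘ (id X ⊗₁ c))
  split-⊗ʳ₃ = ≈.trans split-⊗ʳ (refl⟩∘⟨ split-⊗ʳ)

  split-⊗ʳ₅ : ∀ {X A0 A1 A2 A3 A4 A5} {a : Hom A4 A5} {b : Hom A3 A4} {c : Hom A2 A3} {d : Hom A1 A2} {f : Hom A0 A1} →
         id X ⊗₁ (a ∘ (b ∘ (c ∘ (d ∘ f)))) ≈ (id X ⊗₁ a) ∘ ((id X ⊗₁ b) ∘ ((id X ⊗₁ c) ∘ ((id X ⊗₁ d) ∘ (id X ⊗₁ f))))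
  split-⊗ʳ₅ = ≈.trans split-⊗ʳ (refl⟩∘⟨ ≈.trans split-⊗ʳ (refl⟩∘⟨ ≈.trans split-⊗ʳ (refl⟩∘⟨ split-⊗ʳ)))

  id⊗-inverse : ∀ {A B D} {f : Hom B D} {g : Hom D B} → f ∘ g ≈ id D → (id A ⊗₁ f) ∘ (id A ⊗₁ g) ≈ id (A ⊗₀ D)
  id⊗-inverse p = ≈.trans merge-⊗ (≈.trans (idˡ ⟩⊗⟨ p) id⊗id)

  ⊗id-inverse : ∀ {A B D} {f : Hom B D} {g : Hom D B} → f ∘ g ≈ id D → (f ⊗₁ id A) ∘ (g ⊗₁ id A) ≈ id (D ⊗₀ A)
  ⊗id-inverse p = ≈.trans merge-⊗ (≈.trans (p ⟩⊗⟨ idˡ) id⊗id)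

  natural-inverse : ∀ {A A' B B'} {i₁ : Hom A A'} {j₁ : Hom A' A} {i₂ : Hom B B'} {j₂ : Hom B' B}
           {f : Hom A B} {g : Hom A' B'} →
           j₂ ∘ i₂ ≈ id B → i₁ ∘ j₁ ≈ id A' → i₂ ∘ f ≈ g ∘ i₁ → f ∘ j₁ ≈ j₂ ∘ g
  natural-inverse {i₁ = i₁} {j₁} {i₂} {j₂} {f} {g} e2 e1 n = begin
    f ∘ j₁ ≈⟨ idˡ ⟨
    id _ ∘ (f ∘ j₁) ≈⟨ e2 ⟩∘⟨refl ⟨
    (j₂ ∘ i₂) ∘ (f ∘ j₁) ≈⟨ pullʳ (pullˡ n) ⟩
    j₂ ∘ ((g ∘ i₁) ∘ j₁) ≈⟨ refl⟩∘⟨ pullʳ e1 ⟩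
    j₂ ∘ (g ∘ id _) ≈⟨ refl⟩∘⟨ idʳ ⟩
    j₂ ∘ g ∎

  epi-cancel : ∀ {A B D} {f g : Hom B D} {i : Hom A B} {j : Hom B A} → i ∘ j ≈ id B →
               f ∘ i ≈ g ∘ i → f ≈ g
  epi-cancel {f = f} {g} {i} {j} ij q = begin
    f           ≈⟨ introʳ ij ⟩
    f ∘ (i ∘ j) ≈⟨ sym-assoc _ _ _ ⟩
    (f ∘ i) ∘ j ≈⟨ q ⟩∘⟨refl ⟩
    (g ∘ i) ∘ j ≈⟨ pullʳ ij ⟩
    g ∘ id _    ≈⟨ idʳ ⟩
    g           ∎

  mono-cancel : ∀ {A B D} {f g : Hom A B} {i : Hom B D} {j : Hom D B} → j ∘ i ≈ id B →
               i ∘ f ≈ i ∘ g → f ≈ g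
  mono-cancel {f = f} {g} {i} {j} ji q = begin
    f           ≈⟨ cancelˡ ji ⟨
    j ∘ (i ∘ f) ≈⟨ refl⟩∘⟨ q ⟩
    j ∘ (i ∘ g) ≈⟨ cancelˡ ji ⟩
    g           ∎

  α-nat : ∀ {A A' B B' D D'} {f : Hom A A'} {g : Hom B B'} {h : Hom D D'} →
           α⇒ ∘ ((f ⊗₁ g) ⊗₁ h) ≈ (f ⊗₁ (g ⊗₁ h)) ∘ α⇒
  α-nat = α-natural _ _ _

  α⁻¹-nat : ∀ {A A' B B' D D'} {f : Hom A A'} {g : Hom B B'} {h : Hom D D'} →
           α⇐ ∘ (f ⊗₁ (g ⊗₁ h)) ≈ ((f ⊗₁ g) ⊗₁ h) ∘ α⇐
  α⁻¹-nat = ≈.sym (natural-inverse (α-isoˡ _ _ _) (α-isoʳ _ _ _) (α-natural _ _ _))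

  α-nat₁ : ∀ {x x' y z} {f : Hom x x'} → (f ⊗₁ id (y ⊗₀ z)) ∘ α x y z ≈ α x' y z ∘ ((f ⊗₁ id y) ⊗₁ id z)
  α-nat₁ = ≈.trans ((≈.refl ⟩⊗⟨ ≈.sym id⊗id) ⟩∘⟨refl) (≈.sym α-nat)

  α-nat₂₃ : ∀ {x y y' z z'} {f : Hom y y'} {g : Hom z z'} → (id x ⊗₁ (f ⊗₁ g)) ∘ α x y z ≈ α x y' z' ∘ ((id x ⊗₁ f) ⊗₁ g)
  α-nat₂₃ = ≈.sym α-nat

  λ-nat : ∀ {A B} {f : Hom A B} → λ⇒ ∘ (id I ⊗₁ f) ≈ f ∘ λ⇒
  λ-nat = unitˡ-natural _

  ρ-nat : ∀ {A B} {f : Hom A B} → ρ⇒ ∘ (f ⊗₁ id I) ≈ f ∘ ρ⇒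
  ρ-nat = unitʳ-natural _

  σ-nat : ∀ {A A' B B'} {f : Hom A A'} {g : Hom B B'} → σ⇒ ∘ (f ⊗₁ g) ≈ (g ⊗₁ f) ∘ σ⇒
  σ-nat = σ-natural _ _

  α⁻¹∘α : ∀ {A B D} → α⇐ ∘ α⇒ ≈ id ((A ⊗₀ B) ⊗₀ D)
  α⁻¹∘α = α-isoˡ _ _ _

  α∘α⁻¹ : ∀ {A B D} → α⇒ ∘ α⇐ ≈ id (A ⊗₀ (B ⊗₀ D))
  α∘α⁻¹ = α-isoʳ _ _ _

  σ∘σ : ∀ {A B} → σ⇒ ∘ σ⇒ ≈ id (A ⊗₀ B)
  σ∘σ = σ-involutive _ _

  I⊗-injective : ∀ {A B} {f g : Hom A B} → id I ⊗₁ f ≈ id I ⊗₁ g → f ≈ g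
  I⊗-injective {f = f} {g} q = epi-cancel (unitˡ-isoʳ _) (begin
    f ∘ λ⇒            ≈⟨ λ-nat ⟨
    λ⇒ ∘ (id I ⊗₁ f) ≈⟨ refl⟩∘⟨ q ⟩
    λ⇒ ∘ (id I ⊗₁ g) ≈⟨ λ-nat ⟩
    g ∘ λ⇒            ∎)

  ⊗I-injective : ∀ {A B} {f g : Hom A B} → f ⊗₁ id I ≈ g ⊗₁ id I → f ≈ g
  ⊗I-injective {f = f} {g} q = epi-cancel (unitʳ-isoʳ _) (begin
    f ∘ ρ⇒            ≈⟨ ρ-nat ⟨
    ρ⇒ ∘ (f ⊗₁ id I) ≈⟨ refl⟩∘⟨ q ⟩
    ρ⇒ ∘ (g ⊗₁ id I) ≈⟨ ρ-nat ⟩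
    g ∘ ρ⇒            ∎)

module Associators {o ℓ e : Level} (𝒢 : GSMonoidal o ℓ e) where
  open GSMonoidal 𝒢
  open Reasoning 𝒢

  α∘α⊗id-inverse : ∀ x y z w → (α x (y ⊗₀ z) w ∘ (α x y z ⊗₁ id w)) ∘ ((α⁻¹ x y z ⊗₁ id w) ∘ α⁻¹ x (y ⊗₀ z) w) ≈ id _
  α∘α⊗id-inverse x y z w = ≈.trans (pullʳ (cancelˡ (⊗id-inverse α∘α⁻¹))) α∘α⁻¹

  pentagon-α⁻¹∘id⊗α : ∀ x y w z → α⁻¹ x y (w ⊗₀ z) ∘ (id x ⊗₁ α y w z)
                   ≈ α (x ⊗₀ y) w z ∘ ((α⁻¹ x y w ⊗₁ id z) ∘ α⁻¹ x (y ⊗₀ w) z)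
  pentagon-α⁻¹∘id⊗α x y w z = begin
    α⁻¹ x y (w ⊗₀ z) ∘ (id x ⊗₁ α y w z)
      ≈⟨ introʳ (α∘α⊗id-inverse x y w z) ⟩
    (α⁻¹ x y (w ⊗₀ z) ∘ (id x ⊗₁ α y w z)) ∘ ((α x (y ⊗₀ w) z ∘ (α x y w ⊗₁ id z)) ∘ ((α⁻¹ x y w ⊗₁ id z) ∘ α⁻¹ x (y ⊗₀ w) z))
      ≈⟨ pullʳ (pullˡ (pentagon x y w z)) ⟩
    α⁻¹ x y (w ⊗₀ z) ∘ ((α x y (w ⊗₀ z) ∘ α (x ⊗₀ y) w z) ∘ ((α⁻¹ x y w ⊗₁ id z) ∘ α⁻¹ x (y ⊗₀ w) z))
      ≈⟨ refl⟩∘⟨ assoc _ _ _ ⟩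
    α⁻¹ x y (w ⊗₀ z) ∘ (α x y (w ⊗₀ z) ∘ (α (x ⊗₀ y) w z ∘ ((α⁻¹ x y w ⊗₁ id z) ∘ α⁻¹ x (y ⊗₀ w) z)))
      ≈⟨ cancelˡ α⁻¹∘α ⟩
    α (x ⊗₀ y) w z ∘ ((α⁻¹ x y w ⊗₁ id z) ∘ α⁻¹ x (y ⊗₀ w) z) ∎

  pentagon-id⊗α⁻¹ : ∀ w x y z → (id w ⊗₁ α⁻¹ x y z) ∘ (α w x (y ⊗₀ z) ∘ α (w ⊗₀ x) y z)
                   ≈ α w (x ⊗₀ y) z ∘ (α w x y ⊗₁ id z)
  pentagon-id⊗α⁻¹ w x y z = begin
    (id w ⊗₁ α⁻¹ x y z) ∘ (α w x (y ⊗₀ z) ∘ α (w ⊗₀ x) y z) ≈⟨ refl⟩∘⟨ pentagon w x y z ⟨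
    (id w ⊗₁ α⁻¹ x y z) ∘ ((id w ⊗₁ α x y z) ∘ (α w (x ⊗₀ y) z ∘ (α w x y ⊗₁ id z)))
      ≈⟨ cancelˡ (id⊗-inverse α⁻¹∘α) ⟩
    α w (x ⊗₀ y) z ∘ (α w x y ⊗₁ id z) ∎

  pentagon-α⁻¹∘id⊗α∘α : ∀ x y w z → α⁻¹ x y (w ⊗₀ z) ∘ ((id x ⊗₁ α y w z) ∘ α x (y ⊗₀ w) z)
                   ≈ α (x ⊗₀ y) w z ∘ (α⁻¹ x y w ⊗₁ id z)
  pentagon-α⁻¹∘id⊗α∘α x y w z = begin
    α⁻¹ x y (w ⊗₀ z) ∘ ((id x ⊗₁ α y w z) ∘ α x (y ⊗₀ w) z) ≈⟨ sym-assoc _ _ _ ⟩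
    (α⁻¹ x y (w ⊗₀ z) ∘ (id x ⊗₁ α y w z)) ∘ α x (y ⊗₀ w) z ≈⟨ pentagon-α⁻¹∘id⊗α x y w z ⟩∘⟨refl ⟩
    (α (x ⊗₀ y) w z ∘ ((α⁻¹ x y w ⊗₁ id z) ∘ α⁻¹ x (y ⊗₀ w) z)) ∘ α x (y ⊗₀ w) z ≈⟨ pullʳ (pullʳ α⁻¹∘α) ⟩
    α (x ⊗₀ y) w z ∘ ((α⁻¹ x y w ⊗₁ id z) ∘ id _) ≈⟨ refl⟩∘⟨ idʳ ⟩
    α (x ⊗₀ y) w z ∘ (α⁻¹ x y w ⊗₁ id z) ∎

  pentagon-α⊗id∘α⁻¹ : ∀ a c e z → (α a c e ⊗₁ id z) ∘ α⁻¹ (a ⊗₀ c) e z ≈ α⁻¹ a (c ⊗₀ e) z ∘ ((id a ⊗₁ α⁻¹ c e z) ∘ α a c (e ⊗₀ z))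
  pentagon-α⊗id∘α⁻¹ a c e z = begin
    (α a c e ⊗₁ id z) ∘ α⁻¹ (a ⊗₀ c) e z
      ≈⟨ cancelˡ α⁻¹∘α ⟨
    α⁻¹ a (c ⊗₀ e) z ∘ (α a (c ⊗₀ e) z ∘ ((α a c e ⊗₁ id z) ∘ α⁻¹ (a ⊗₀ c) e z))
      ≈⟨ refl⟩∘⟨ cancelˡ (id⊗-inverse α⁻¹∘α) ⟨
    α⁻¹ a (c ⊗₀ e) z ∘ ((id a ⊗₁ α⁻¹ c e z) ∘ ((id a ⊗₁ α c e z) ∘ (α a (c ⊗₀ e) z ∘ ((α a c e ⊗₁ id z) ∘ α⁻¹ (a ⊗₀ c) e z))))
      ≈⟨ refl⟩∘⟨ refl⟩∘⟨ ≈.trans (refl⟩∘⟨ sym-assoc _ _ _) (sym-assoc _ _ _) ⟩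
    α⁻¹ a (c ⊗₀ e) z ∘ ((id a ⊗₁ α⁻¹ c e z) ∘ (((id a ⊗₁ α c e z) ∘ (α a (c ⊗₀ e) z ∘ (α a c e ⊗₁ id z))) ∘ α⁻¹ (a ⊗₀ c) e z))
      ≈⟨ refl⟩∘⟨ refl⟩∘⟨ (pentagon a c e z ⟩∘⟨refl) ⟩
    α⁻¹ a (c ⊗₀ e) z ∘ ((id a ⊗₁ α⁻¹ c e z) ∘ ((α a c (e ⊗₀ z) ∘ α (a ⊗₀ c) e z) ∘ α⁻¹ (a ⊗₀ c) e z))
      ≈⟨ refl⟩∘⟨ refl⟩∘⟨ ≈.trans (pullʳ α∘α⁻¹) idʳ ⟩
    α⁻¹ a (c ⊗₀ e) z ∘ ((id a ⊗₁ α⁻¹ c e z) ∘ α a c (e ⊗₀ z)) ∎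

  hexagon-σ : ∀ x y y' → σ x (y ⊗₀ y') ≈ α⁻¹ y y' x ∘ ((id y ⊗₁ σ x y') ∘ (α y x y' ∘ ((σ x y ⊗₁ id y') ∘ α⁻¹ x y y')))
  hexagon-σ x y y' = begin
    σ x (y ⊗₀ y') ≈⟨ cancelˡ α⁻¹∘α ⟨
    α⁻¹ y y' x ∘ (α y y' x ∘ σ x (y ⊗₀ y')) ≈⟨ refl⟩∘⟨ introʳ α∘α⁻¹ ⟩
    α⁻¹ y y' x ∘ ((α y y' x ∘ σ x (y ⊗₀ y')) ∘ (α x y y' ∘ α⁻¹ x y y')) ≈⟨ refl⟩∘⟨ pullʳ (sym-assoc _ _ _) ⟩
    α⁻¹ y y' x ∘ (α y y' x ∘ ((σ x (y ⊗₀ y') ∘ α x y y') ∘ α⁻¹ x y y')) ≈⟨ refl⟩∘⟨ sym-assoc _ _ _ ⟩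
    α⁻¹ y y' x ∘ ((α y y' x ∘ (σ x (y ⊗₀ y') ∘ α x y y')) ∘ α⁻¹ x y y') ≈⟨ refl⟩∘⟨ (hexagon x y y' ⟩∘⟨refl) ⟩
    α⁻¹ y y' x ∘ (((id y ⊗₁ σ x y') ∘ (α y x y' ∘ (σ x y ⊗₁ id y'))) ∘ α⁻¹ x y y') ≈⟨ refl⟩∘⟨ pullʳ (assoc _ _ _) ⟩
    α⁻¹ y y' x ∘ ((id y ⊗₁ σ x y') ∘ (α y x y' ∘ ((σ x y ⊗₁ id y') ∘ α⁻¹ x y y'))) ∎

  hexagon-σ⊗id : ∀ x y y' z → (σ x (y ⊗₀ y') ⊗₁ id z) ∘ α⁻¹ x (y ⊗₀ y') z
                 ≈ (α⁻¹ y y' x ⊗₁ id z) ∘ (((id y ⊗₁ σ x y') ⊗₁ id z) ∘ ((α y x y' ⊗₁ id z)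
                   ∘ (((σ x y ⊗₁ id y') ⊗₁ id z) ∘ ((α⁻¹ x y y' ⊗₁ id z) ∘ α⁻¹ x (y ⊗₀ y') z))))
  hexagon-σ⊗id x y y' z =
    ≈.trans ((hexagon-σ x y y' ⟩⊗⟨ ≈.refl) ⟩∘⟨refl) (≈.trans (split-⊗ˡ₅ ⟩∘⟨refl) assoc₅)

module Unitors {o ℓ e : Level} (𝒢 : GSMonoidal o ℓ e) where
  open GSMonoidal 𝒢
  open Reasoning 𝒢
  open Associators 𝒢

  -- Kelly: id I ⊗ - is faithful, and after it both sides agree by the pentagon and triangle.
  unitˡ-α : ∀ {A B} → λ⇒ ∘ α I A B ≈ λ⇒ ⊗₁ id B
  unitˡ-α {A} {B} = I⊗-injective (epi-cancel {i = α I (I ⊗₀ A) B ∘ (α I I A ⊗₁ id B)}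
                                     {j = (α⁻¹ I I A ⊗₁ id B) ∘ α⁻¹ I (I ⊗₀ A) B} (α∘α⊗id-inverse I I A B) (begin
    (id I ⊗₁ (λ⇒ ∘ α I A B)) ∘ (α I (I ⊗₀ A) B ∘ (α I I A ⊗₁ id B))
      ≈⟨ split-⊗ʳ ⟩∘⟨refl ⟩
    ((id I ⊗₁ λ⇒) ∘ (id I ⊗₁ α I A B)) ∘ (α I (I ⊗₀ A) B ∘ (α I I A ⊗₁ id B))
      ≈⟨ pullʳ (pentagon I I A B) ⟩
    (id I ⊗₁ λ⇒) ∘ (α I I (A ⊗₀ B) ∘ α (I ⊗₀ I) A B)
      ≈⟨ pullˡ (triangle I (A ⊗₀ B)) ⟩
    (unitʳ I ⊗₁ id (A ⊗₀ B)) ∘ α (I ⊗₀ I) A B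
      ≈⟨ (≈.refl ⟩⊗⟨ id⊗id) ⟩∘⟨refl ⟨
    (unitʳ I ⊗₁ (id A ⊗₁ id B)) ∘ α (I ⊗₀ I) A B
      ≈⟨ α-nat ⟨
    α I A B ∘ ((unitʳ I ⊗₁ id A) ⊗₁ id B)
      ≈⟨ refl⟩∘⟨ (triangle I A ⟩⊗⟨ ≈.refl) ⟨
    α I A B ∘ (((id I ⊗₁ λ⇒) ∘ α I I A) ⊗₁ id B)
      ≈⟨ refl⟩∘⟨ split-⊗ˡ ⟩
    α I A B ∘ (((id I ⊗₁ λ⇒) ⊗₁ id B) ∘ (α I I A ⊗₁ id B))
      ≈⟨ pullˡ α-nat ⟩
    ((id I ⊗₁ (λ⇒ ⊗₁ id B)) ∘ α I (I ⊗₀ A) B) ∘ (α I I A ⊗₁ id B)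
      ≈⟨ assoc _ _ _ ⟩
    (id I ⊗₁ (λ⇒ ⊗₁ id B)) ∘ (α I (I ⊗₀ A) B ∘ (α I I A ⊗₁ id B)) ∎))

  unitʳ-α : ∀ {A B} → (id A ⊗₁ unitʳ B) ∘ α A B I ≈ unitʳ (A ⊗₀ B)
  unitʳ-α {A} {B} = ⊗I-injective (mono-cancel {i = α A B I} {j = α⁻¹ A B I} α⁻¹∘α (≈.sym (begin
    α A B I ∘ (ρ⇒ ⊗₁ id I)
      ≈⟨ refl⟩∘⟨ triangle (A ⊗₀ B) I ⟨
    α A B I ∘ ((id (A ⊗₀ B) ⊗₁ λ⇒) ∘ α (A ⊗₀ B) I I)
      ≈⟨ refl⟩∘⟨ ((id⊗id ⟩⊗⟨ ≈.refl) ⟩∘⟨refl) ⟨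
    α A B I ∘ (((id A ⊗₁ id B) ⊗₁ λ⇒) ∘ α (A ⊗₀ B) I I)
      ≈⟨ pullˡ α-nat ⟩
    ((id A ⊗₁ (id B ⊗₁ λ⇒)) ∘ α A B (I ⊗₀ I)) ∘ α (A ⊗₀ B) I I
      ≈⟨ pullʳ (≈.sym (pentagon A B I I)) ⟩
    (id A ⊗₁ (id B ⊗₁ λ⇒)) ∘ ((id A ⊗₁ α B I I) ∘ (α A (B ⊗₀ I) I ∘ (α A B I ⊗₁ id I)))
      ≈⟨ pullˡ (≈.trans merge-⊗ (idˡ ⟩⊗⟨ triangle B I)) ⟩
    (id A ⊗₁ (ρ⇒ ⊗₁ id I)) ∘ (α A (B ⊗₀ I) I ∘ (α A B I ⊗₁ id I))
      ≈⟨ extendˡ α-nat ⟨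
    α A B I ∘ (((id A ⊗₁ ρ⇒) ⊗₁ id I) ∘ (α A B I ⊗₁ id I))
      ≈⟨ refl⟩∘⟨ merge-⊗ ⟩
    α A B I ∘ (((id A ⊗₁ ρ⇒) ∘ α A B I) ⊗₁ (id I ∘ id I))
      ≈⟨ refl⟩∘⟨ (≈.refl ⟩⊗⟨ idˡ) ⟩
    α A B I ∘ (((id A ⊗₁ ρ⇒) ∘ α A B I) ⊗₁ id I) ∎)))

  unitˡ-σ : ∀ {A} → unitˡ A ∘ σ A I ≈ unitʳ A
  unitˡ-σ {A} = ⊗I-injective (mono-cancel {i = σ A I} {j = σ I A} σ∘σ (≈.sym (begin
    σ A I ∘ (unitʳ A ⊗₁ id I)
      ≈⟨ refl⟩∘⟨ triangle A I ⟨
    σ A I ∘ ((id A ⊗₁ λ⇒) ∘ α A I I)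
      ≈⟨ pullˡ σ-nat ⟩
    ((λ⇒ ⊗₁ id A) ∘ σ A (I ⊗₀ I)) ∘ α A I I
      ≈⟨ pullˡ unitˡ-α ⟩∘⟨refl ⟨
    (λ⇒ ∘ (α I I A ∘ σ A (I ⊗₀ I))) ∘ α A I I
      ≈⟨ pullʳ (assoc _ _ _) ⟩
    λ⇒ ∘ (α I I A ∘ (σ A (I ⊗₀ I) ∘ α A I I))
      ≈⟨ refl⟩∘⟨ hexagon A I I ⟩
    λ⇒ ∘ ((id I ⊗₁ σ A I) ∘ (α I A I ∘ (σ A I ⊗₁ id I)))
      ≈⟨ pullˡ λ-nat ⟩
    (σ A I ∘ λ⇒) ∘ (α I A I ∘ (σ A I ⊗₁ id I))
      ≈⟨ pullʳ (pullˡ unitˡ-α) ⟩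
    σ A I ∘ ((λ⇒ ⊗₁ id I) ∘ (σ A I ⊗₁ id I))
      ≈⟨ refl⟩∘⟨ ≈.trans merge-⊗ (≈.refl ⟩⊗⟨ idˡ) ⟩
    σ A I ∘ ((λ⇒ ∘ σ A I) ⊗₁ id I) ∎)))

  unitʳ-σ : ∀ {A} → unitʳ A ∘ σ I A ≈ unitˡ A
  unitʳ-σ = ≈.trans (≈.sym (unitˡ-σ ⟩∘⟨refl)) (≈.trans (pullʳ σ∘σ) idʳ)

  unitʳ-α⁻¹ : ∀ A B → unitʳ (A ⊗₀ B) ∘ α⁻¹ A B I ≈ id A ⊗₁ unitʳ B
  unitʳ-α⁻¹ A B = ≈.trans (≈.sym unitʳ-α ⟩∘⟨refl) (≈.trans (pullʳ α∘α⁻¹) idʳ)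

module Interchange {o ℓ e : Level} (𝒢 : GSMonoidal o ℓ e) where
  open GSMonoidal 𝒢
  open Reasoning 𝒢
  open Associators 𝒢

  swap₁₂ : ∀ X Y Z → Hom (X ⊗₀ (Y ⊗₀ Z)) (Y ⊗₀ (X ⊗₀ Z))
  swap₁₂ X Y Z = α Y X Z ∘ ((σ X Y ⊗₁ id Z) ∘ α⁻¹ X Y Z)

  interchange : ∀ W X Y Z → Hom ((W ⊗₀ X) ⊗₀ (Y ⊗₀ Z)) ((W ⊗₀ Y) ⊗₀ (X ⊗₀ Z))
  interchange W X Y Z = α⁻¹ W Y (X ⊗₀ Z) ∘ ((id W ⊗₁ swap₁₂ X Y Z) ∘ α W X (Y ⊗₀ Z))

  swap₁₂-natural : ∀ {X X' Y Y' Z Z'} {g : Hom X X'} {h : Hom Y Y'} {k : Hom Z Z'} →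
           swap₁₂ _ _ _ ∘ (g ⊗₁ (h ⊗₁ k)) ≈ (h ⊗₁ (g ⊗₁ k)) ∘ swap₁₂ _ _ _
  swap₁₂-natural {g = g} {h} {k} = begin
    (α⇒ ∘ ((σ⇒ ⊗₁ ι) ∘ α⇐)) ∘ (g ⊗₁ (h ⊗₁ k))
      ≈⟨ pullʳ (pullʳ α⁻¹-nat) ⟩
    α⇒ ∘ ((σ⇒ ⊗₁ ι) ∘ (((g ⊗₁ h) ⊗₁ k) ∘ α⇐))
      ≈⟨ refl⟩∘⟨ pullˡ (≈.trans merge-⊗ (σ-nat ⟩⊗⟨ ≈.trans idˡ (≈.sym idʳ))) ⟩
    α⇒ ∘ (((h ⊗₁ g) ∘ σ⇒) ⊗₁ (k ∘ ι)) ∘ α⇐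
      ≈⟨ refl⟩∘⟨ (split-⊗ ⟩∘⟨refl) ⟩
    α⇒ ∘ (((h ⊗₁ g) ⊗₁ k) ∘ (σ⇒ ⊗₁ ι)) ∘ α⇐
      ≈⟨ refl⟩∘⟨ assoc _ _ _ ⟩
    α⇒ ∘ (((h ⊗₁ g) ⊗₁ k) ∘ ((σ⇒ ⊗₁ ι) ∘ α⇐))
      ≈⟨ pullˡ α-nat ⟩
    ((h ⊗₁ (g ⊗₁ k)) ∘ α⇒) ∘ ((σ⇒ ⊗₁ ι) ∘ α⇐)
      ≈⟨ assoc _ _ _ ⟩
    (h ⊗₁ (g ⊗₁ k)) ∘ (α⇒ ∘ ((σ⇒ ⊗₁ ι) ∘ α⇐)) ∎

  interchange-natural : ∀ {W W' X X' Y Y' Z Z'} {f : Hom W W'} {g : Hom X X'} {h : Hom Y Y'} {k : Hom Z Z'} →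
            interchange _ _ _ _ ∘ ((f ⊗₁ g) ⊗₁ (h ⊗₁ k)) ≈ ((f ⊗₁ h) ⊗₁ (g ⊗₁ k)) ∘ interchange _ _ _ _
  interchange-natural {f = f} {g} {h} {k} = begin
    (α⇐ ∘ ((ι ⊗₁ swap₁₂ _ _ _) ∘ α⇒)) ∘ ((f ⊗₁ g) ⊗₁ (h ⊗₁ k))
      ≈⟨ pullʳ (pullʳ α-nat) ⟩
    α⇐ ∘ ((ι ⊗₁ swap₁₂ _ _ _) ∘ ((f ⊗₁ (g ⊗₁ (h ⊗₁ k))) ∘ α⇒))
      ≈⟨ refl⟩∘⟨ pullˡ (≈.trans merge-⊗ (≈.trans idˡ (≈.sym idʳ) ⟩⊗⟨ swap₁₂-natural)) ⟩
    α⇐ ∘ (((f ∘ ι) ⊗₁ ((h ⊗₁ (g ⊗₁ k)) ∘ swap₁₂ _ _ _)) ∘ α⇒)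
      ≈⟨ refl⟩∘⟨ (split-⊗ ⟩∘⟨refl) ⟩
    α⇐ ∘ (((f ⊗₁ (h ⊗₁ (g ⊗₁ k))) ∘ (ι ⊗₁ swap₁₂ _ _ _)) ∘ α⇒)
      ≈⟨ refl⟩∘⟨ assoc _ _ _ ⟩
    α⇐ ∘ ((f ⊗₁ (h ⊗₁ (g ⊗₁ k))) ∘ ((ι ⊗₁ swap₁₂ _ _ _) ∘ α⇒))
      ≈⟨ pullˡ α⁻¹-nat ⟩
    (((f ⊗₁ h) ⊗₁ (g ⊗₁ k)) ∘ α⇐) ∘ ((ι ⊗₁ swap₁₂ _ _ _) ∘ α⇒)
      ≈⟨ assoc _ _ _ ⟩
    ((f ⊗₁ h) ⊗₁ (g ⊗₁ k)) ∘ (α⇐ ∘ ((ι ⊗₁ swap₁₂ _ _ _) ∘ α⇒)) ∎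

  swap₁₂-inverse : ∀ x y z → swap₁₂ y x z ∘ swap₁₂ x y z ≈ id _
  swap₁₂-inverse x y z = begin
    (α x y z ∘ ((σ y x ⊗₁ id z) ∘ α⁻¹ y x z)) ∘ (α y x z ∘ ((σ x y ⊗₁ id z) ∘ α⁻¹ x y z))
      ≈⟨ pullʳ (pullʳ (cancelˡ α⁻¹∘α)) ⟩
    α x y z ∘ ((σ y x ⊗₁ id z) ∘ ((σ x y ⊗₁ id z) ∘ α⁻¹ x y z))
      ≈⟨ refl⟩∘⟨ pullˡ (⊗id-inverse σ∘σ) ⟩
    α x y z ∘ (id _ ∘ α⁻¹ x y z) ≈⟨ refl⟩∘⟨ idˡ ⟩
    α x y z ∘ α⁻¹ x y z ≈⟨ α∘α⁻¹ ⟩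
    id _ ∎

  swap₁₂-⊗₂ : ∀ x y y' z → swap₁₂ x (y ⊗₀ y') z ≈
       α⁻¹ y y' (x ⊗₀ z) ∘ ((id y ⊗₁ swap₁₂ x y' z) ∘ (swap₁₂ x y (y' ⊗₀ z) ∘ (id x ⊗₁ α y y' z)))
  swap₁₂-⊗₂ x y y' z = ≈.sym (begin
    α⁻¹ y y' (x ⊗₀ z) ∘ ((id y ⊗₁ swap₁₂ x y' z) ∘ (swap₁₂ x y (y' ⊗₀ z) ∘ (id x ⊗₁ α y y' z)))
      ≈⟨ refl⟩∘⟨ refl⟩∘⟨ swap₁₂∘id⊗α ⟩
    α⁻¹ y y' (x ⊗₀ z) ∘ ((id y ⊗₁ swap₁₂ x y' z) ∘ (α y x (y' ⊗₀ z) ∘ (α (y ⊗₀ x) y' z ∘ σ-front)))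
      ≈⟨ refl⟩∘⟨ ((split-⊗ʳ ⟩∘⟨refl)) ⟩
    α⁻¹ y y' (x ⊗₀ z) ∘ (((id y ⊗₁ α y' x z) ∘ (id y ⊗₁ ((σ x y' ⊗₁ id z) ∘ α⁻¹ x y' z))) ∘ (α y x (y' ⊗₀ z) ∘ (α (y ⊗₀ x) y' z ∘ σ-front)))
      ≈⟨ refl⟩∘⟨ pullʳ ((split-⊗ʳ ⟩∘⟨refl)) ⟩
    α⁻¹ y y' (x ⊗₀ z) ∘ ((id y ⊗₁ α y' x z) ∘ (((id y ⊗₁ (σ x y' ⊗₁ id z)) ∘ (id y ⊗₁ α⁻¹ x y' z)) ∘ (α y x (y' ⊗₀ z) ∘ (α (y ⊗₀ x) y' z ∘ σ-front))))
      ≈⟨ refl⟩∘⟨ refl⟩∘⟨ pullʳ (≈.trans (≈.trans (refl⟩∘⟨ sym-assoc _ _ _) (sym-assoc _ _ _)) (≈.trans (pentagon-id⊗α⁻¹ y x y' z ⟩∘⟨refl) (assoc _ _ _))) ⟩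
    α⁻¹ y y' (x ⊗₀ z) ∘ ((id y ⊗₁ α y' x z) ∘ ((id y ⊗₁ (σ x y' ⊗₁ id z)) ∘ (α y (x ⊗₀ y') z ∘ ((α y x y' ⊗₁ id z) ∘ σ-front))))
      ≈⟨ refl⟩∘⟨ refl⟩∘⟨ pullˡ α-nat₂₃ ⟩
    α⁻¹ y y' (x ⊗₀ z) ∘ ((id y ⊗₁ α y' x z) ∘ ((α y (y' ⊗₀ x) z ∘ ((id y ⊗₁ σ x y') ⊗₁ id z)) ∘ ((α y x y' ⊗₁ id z) ∘ σ-front)))
      ≈⟨ refl⟩∘⟨ refl⟩∘⟨ assoc _ _ _ ⟩
    α⁻¹ y y' (x ⊗₀ z) ∘ ((id y ⊗₁ α y' x z) ∘ (α y (y' ⊗₀ x) z ∘ (((id y ⊗₁ σ x y') ⊗₁ id z) ∘ ((α y x y' ⊗₁ id z) ∘ σ-front))))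
      ≈⟨ refl⟩∘⟨ sym-assoc _ _ _ ⟩
    α⁻¹ y y' (x ⊗₀ z) ∘ (((id y ⊗₁ α y' x z) ∘ α y (y' ⊗₀ x) z) ∘ (((id y ⊗₁ σ x y') ⊗₁ id z) ∘ ((α y x y' ⊗₁ id z) ∘ σ-front)))
      ≈⟨ sym-assoc _ _ _ ⟩
    (α⁻¹ y y' (x ⊗₀ z) ∘ ((id y ⊗₁ α y' x z) ∘ α y (y' ⊗₀ x) z)) ∘ (((id y ⊗₁ σ x y') ⊗₁ id z) ∘ ((α y x y' ⊗₁ id z) ∘ σ-front))
      ≈⟨ pentagon-α⁻¹∘id⊗α∘α y y' x z ⟩∘⟨refl ⟩
    (α (y ⊗₀ y') x z ∘ (α⁻¹ y y' x ⊗₁ id z)) ∘ (((id y ⊗₁ σ x y') ⊗₁ id z) ∘ ((α y x y' ⊗₁ id z) ∘ σ-front))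
      ≈⟨ assoc _ _ _ ⟩
    α (y ⊗₀ y') x z ∘ ((α⁻¹ y y' x ⊗₁ id z) ∘ (((id y ⊗₁ σ x y') ⊗₁ id z) ∘ ((α y x y' ⊗₁ id z) ∘ (((σ x y ⊗₁ id y') ⊗₁ id z) ∘ ((α⁻¹ x y y' ⊗₁ id z) ∘ α⁻¹ x (y ⊗₀ y') z)))))
      ≈⟨ refl⟩∘⟨ hexagon-σ⊗id x y y' z ⟨
    α (y ⊗₀ y') x z ∘ ((σ x (y ⊗₀ y') ⊗₁ id z) ∘ α⁻¹ x (y ⊗₀ y') z) ∎)
    where
    σ-front : Hom (x ⊗₀ ((y ⊗₀ y') ⊗₀ z)) (((y ⊗₀ x) ⊗₀ y') ⊗₀ z)
    σ-front = ((σ x y ⊗₁ id y') ⊗₁ id z) ∘ ((α⁻¹ x y y' ⊗₁ id z) ∘ α⁻¹ x (y ⊗₀ y') z)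
    swap₁₂∘id⊗α : swap₁₂ x y (y' ⊗₀ z) ∘ (id x ⊗₁ α y y' z) ≈ α y x (y' ⊗₀ z) ∘ (α (y ⊗₀ x) y' z ∘ σ-front)
    swap₁₂∘id⊗α = begin
      (α y x (y' ⊗₀ z) ∘ ((σ x y ⊗₁ id (y' ⊗₀ z)) ∘ α⁻¹ x y (y' ⊗₀ z))) ∘ (id x ⊗₁ α y y' z)
        ≈⟨ pullʳ (assoc _ _ _) ⟩
      α y x (y' ⊗₀ z) ∘ ((σ x y ⊗₁ id (y' ⊗₀ z)) ∘ (α⁻¹ x y (y' ⊗₀ z) ∘ (id x ⊗₁ α y y' z)))
        ≈⟨ refl⟩∘⟨ refl⟩∘⟨ pentagon-α⁻¹∘id⊗α x y y' z ⟩
      α y x (y' ⊗₀ z) ∘ ((σ x y ⊗₁ id (y' ⊗₀ z)) ∘ (α (x ⊗₀ y) y' z ∘ ((α⁻¹ x y y' ⊗₁ id z) ∘ α⁻¹ x (y ⊗₀ y') z)))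
        ≈⟨ refl⟩∘⟨ extendˡ α-nat₁ ⟩
      α y x (y' ⊗₀ z) ∘ (α (y ⊗₀ x) y' z ∘ σ-front) ∎

  -- swap₁₂ (x ⊗ x') y z inverts swap₁₂ y (x ⊗ x') z, which swap₁₂-⊗₂ expands into factors with known inverses.
  swap₁₂-⊗₁ : ∀ x x' y z → swap₁₂ (x ⊗₀ x') y z ≈
       (id y ⊗₁ α⁻¹ x x' z) ∘ (swap₁₂ x y (x' ⊗₀ z) ∘ ((id x ⊗₁ swap₁₂ x' y z) ∘ α x x' (y ⊗₀ z)))
  swap₁₂-⊗₁ x x' y z = begin
    swap₁₂ (x ⊗₀ x') y z                ≈⟨ idˡ ⟨
    id _ ∘ swap₁₂ (x ⊗₀ x') y z         ≈⟨ rhs∘rhs⁻¹ ⟩∘⟨refl ⟨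
    (rhs ∘ rhs⁻¹) ∘ swap₁₂ (x ⊗₀ x') y z ≈⟨ pullʳ (≈.trans (≈.sym (swap₁₂-⊗₂ y x x' z) ⟩∘⟨refl) (swap₁₂-inverse (x ⊗₀ x') y z)) ⟩
    rhs ∘ id _                          ≈⟨ idʳ ⟩
    rhs                                 ∎
    where
    rhs⁻¹ : Hom (y ⊗₀ ((x ⊗₀ x') ⊗₀ z)) ((x ⊗₀ x') ⊗₀ (y ⊗₀ z))
    rhs⁻¹ = α⁻¹ x x' (y ⊗₀ z) ∘ ((id x ⊗₁ swap₁₂ y x' z) ∘ (swap₁₂ y x (x' ⊗₀ z) ∘ (id y ⊗₁ α x x' z)))

    rhs : Hom ((x ⊗₀ x') ⊗₀ (y ⊗₀ z)) (y ⊗₀ ((x ⊗₀ x') ⊗₀ z))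
    rhs = (id y ⊗₁ α⁻¹ x x' z) ∘ (swap₁₂ x y (x' ⊗₀ z) ∘ ((id x ⊗₁ swap₁₂ x' y z) ∘ α x x' (y ⊗₀ z)))

    rhs∘rhs⁻¹ : rhs ∘ rhs⁻¹ ≈ id _
    rhs∘rhs⁻¹ = begin
      ((id y ⊗₁ α⁻¹ x x' z) ∘ (swap₁₂ x y (x' ⊗₀ z) ∘ ((id x ⊗₁ swap₁₂ x' y z) ∘ α x x' (y ⊗₀ z)))) ∘ rhs⁻¹
        ≈⟨ pullʳ (pullʳ (pullʳ (cancelˡ α∘α⁻¹))) ⟩
      (id y ⊗₁ α⁻¹ x x' z) ∘ (swap₁₂ x y (x' ⊗₀ z) ∘ ((id x ⊗₁ swap₁₂ x' y z) ∘ ((id x ⊗₁ swap₁₂ y x' z) ∘ (swap₁₂ y x (x' ⊗₀ z) ∘ (id y ⊗₁ α x x' z)))))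
        ≈⟨ refl⟩∘⟨ refl⟩∘⟨ cancelˡ (id⊗-inverse (swap₁₂-inverse y x' z)) ⟩
      (id y ⊗₁ α⁻¹ x x' z) ∘ (swap₁₂ x y (x' ⊗₀ z) ∘ (swap₁₂ y x (x' ⊗₀ z) ∘ (id y ⊗₁ α x x' z)))
        ≈⟨ refl⟩∘⟨ cancelˡ (swap₁₂-inverse y x (x' ⊗₀ z)) ⟩
      (id y ⊗₁ α⁻¹ x x' z) ∘ (id y ⊗₁ α x x' z)
        ≈⟨ id⊗-inverse α⁻¹∘α ⟩
      id _ ∎

  swap₁₂-α : ∀ b c d g → swap₁₂ b c (d ⊗₀ g) ∘ ((id b ⊗₁ α c d g) ∘ α b (c ⊗₀ d) g)
                 ≈ (id c ⊗₁ α b d g) ∘ (α c (b ⊗₀ d) g ∘ (swap₁₂ b c d ⊗₁ id g))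
  swap₁₂-α b c d g = ≈.sym (begin
    (id c ⊗₁ α b d g) ∘ (α c (b ⊗₀ d) g ∘ (swap₁₂ b c d ⊗₁ id g))
      ≈⟨ refl⟩∘⟨ refl⟩∘⟨ ≈.trans split-⊗ˡ (refl⟩∘⟨ split-⊗ˡ) ⟩
    (id c ⊗₁ α b d g) ∘ (α c (b ⊗₀ d) g ∘ ((α c b d ⊗₁ id g) ∘ (((σ b c ⊗₁ id d) ⊗₁ id g) ∘ (α⁻¹ b c d ⊗₁ id g))))
      ≈⟨ ≈.trans (refl⟩∘⟨ sym-assoc _ _ _) (sym-assoc _ _ _) ⟩
    ((id c ⊗₁ α b d g) ∘ (α c (b ⊗₀ d) g ∘ (α c b d ⊗₁ id g))) ∘ (((σ b c ⊗₁ id d) ⊗₁ id g) ∘ (α⁻¹ b c d ⊗₁ id g))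
      ≈⟨ pentagon c b d g ⟩∘⟨refl ⟩
    (α c b (d ⊗₀ g) ∘ α (c ⊗₀ b) d g) ∘ (((σ b c ⊗₁ id d) ⊗₁ id g) ∘ (α⁻¹ b c d ⊗₁ id g))
      ≈⟨ pullʳ (pullˡ α-nat) ⟩
    α c b (d ⊗₀ g) ∘ (((σ b c ⊗₁ (id d ⊗₁ id g)) ∘ α (b ⊗₀ c) d g) ∘ (α⁻¹ b c d ⊗₁ id g))
      ≈⟨ refl⟩∘⟨ ((≈.refl ⟩⊗⟨ id⊗id) ⟩∘⟨refl ⟩∘⟨refl) ⟩
    α c b (d ⊗₀ g) ∘ (((σ b c ⊗₁ id (d ⊗₀ g)) ∘ α (b ⊗₀ c) d g) ∘ (α⁻¹ b c d ⊗₁ id g))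
      ≈⟨ refl⟩∘⟨ pullʳ (≈.sym (pentagon-α⁻¹∘id⊗α∘α b c d g)) ⟩
    α c b (d ⊗₀ g) ∘ ((σ b c ⊗₁ id (d ⊗₀ g)) ∘ (α⁻¹ b c (d ⊗₀ g) ∘ ((id b ⊗₁ α c d g) ∘ α b (c ⊗₀ d) g)))
      ≈⟨ refl⟩∘⟨ sym-assoc _ _ _ ⟩
    α c b (d ⊗₀ g) ∘ (((σ b c ⊗₁ id (d ⊗₀ g)) ∘ α⁻¹ b c (d ⊗₀ g)) ∘ ((id b ⊗₁ α c d g) ∘ α b (c ⊗₀ d) g))
      ≈⟨ sym-assoc _ _ _ ⟩
    swap₁₂ b c (d ⊗₀ g) ∘ ((id b ⊗₁ α c d g) ∘ α b (c ⊗₀ d) g) ∎)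

  -- Both sides of interchange-α reduce to this map.
  interchange-α-nf : ∀ b c d e f → Hom ((b ⊗₀ (c ⊗₀ d)) ⊗₀ (e ⊗₀ f)) ((c ⊗₀ e) ⊗₀ (b ⊗₀ (d ⊗₀ f)))
  interchange-α-nf b c d e f = α⁻¹ c e (b ⊗₀ (d ⊗₀ f)) ∘ ((id c ⊗₁ swap₁₂ b e (d ⊗₀ f)) ∘ ((id c ⊗₁ (id b ⊗₁ swap₁₂ d e f))
        ∘ ((id c ⊗₁ α b d (e ⊗₀ f)) ∘ (α c (b ⊗₀ d) (e ⊗₀ f) ∘ (swap₁₂ b c d ⊗₁ id (e ⊗₀ f))))))

  swap₁₂-interchange-nf : ∀ b c d e f → swap₁₂ b (c ⊗₀ e) (d ⊗₀ f) ∘ ((id b ⊗₁ interchange c d e f) ∘ α b (c ⊗₀ d) (e ⊗₀ f)) ≈ interchange-α-nf b c d e f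
  swap₁₂-interchange-nf b c d e f = begin
    swap₁₂ b (c ⊗₀ e) (d ⊗₀ f) ∘ ((id b ⊗₁ interchange c d e f) ∘ α b (c ⊗₀ d) (e ⊗₀ f))
      ≈⟨ swap₁₂-⊗₂ b c e (d ⊗₀ f) ⟩∘⟨refl ⟩
    (α⁻¹ c e (b ⊗₀ (d ⊗₀ f)) ∘ ((id c ⊗₁ swap₁₂ b e (d ⊗₀ f)) ∘ (swap₁₂ b c (e ⊗₀ (d ⊗₀ f)) ∘ (id b ⊗₁ α c e (d ⊗₀ f)))))
       ∘ ((id b ⊗₁ interchange c d e f) ∘ α b (c ⊗₀ d) (e ⊗₀ f))
      ≈⟨ pullʳ (pullʳ (assoc _ _ _)) ⟩
    α⁻¹ c e (b ⊗₀ (d ⊗₀ f)) ∘ ((id c ⊗₁ swap₁₂ b e (d ⊗₀ f)) ∘ (swap₁₂ b c (e ⊗₀ (d ⊗₀ f)) ∘ ((id b ⊗₁ α c e (d ⊗₀ f))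
       ∘ ((id b ⊗₁ interchange c d e f) ∘ α b (c ⊗₀ d) (e ⊗₀ f)))))
      ≈⟨ refl⟩∘⟨ refl⟩∘⟨ refl⟩∘⟨ inner ⟩
    α⁻¹ c e (b ⊗₀ (d ⊗₀ f)) ∘ ((id c ⊗₁ swap₁₂ b e (d ⊗₀ f)) ∘ (swap₁₂ b c (e ⊗₀ (d ⊗₀ f)) ∘ ((id b ⊗₁ (id c ⊗₁ swap₁₂ d e f))
       ∘ ((id b ⊗₁ α c d (e ⊗₀ f)) ∘ α b (c ⊗₀ d) (e ⊗₀ f)))))
      ≈⟨ refl⟩∘⟨ refl⟩∘⟨ extendˡ swap₁₂-natural ⟩
    α⁻¹ c e (b ⊗₀ (d ⊗₀ f)) ∘ ((id c ⊗₁ swap₁₂ b e (d ⊗₀ f)) ∘ ((id c ⊗₁ (id b ⊗₁ swap₁₂ d e f)) ∘ (swap₁₂ b c (d ⊗₀ (e ⊗₀ f))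
       ∘ ((id b ⊗₁ α c d (e ⊗₀ f)) ∘ α b (c ⊗₀ d) (e ⊗₀ f)))))
      ≈⟨ refl⟩∘⟨ refl⟩∘⟨ refl⟩∘⟨ swap₁₂-α b c d (e ⊗₀ f) ⟩
    interchange-α-nf b c d e f ∎
    where
    inner : (id b ⊗₁ α c e (d ⊗₀ f)) ∘ ((id b ⊗₁ interchange c d e f) ∘ α b (c ⊗₀ d) (e ⊗₀ f))
            ≈ (id b ⊗₁ (id c ⊗₁ swap₁₂ d e f)) ∘ ((id b ⊗₁ α c d (e ⊗₀ f)) ∘ α b (c ⊗₀ d) (e ⊗₀ f))
    inner = begin
      (id b ⊗₁ α c e (d ⊗₀ f)) ∘ ((id b ⊗₁ interchange c d e f) ∘ α b (c ⊗₀ d) (e ⊗₀ f))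
        ≈⟨ pullˡ (≈.trans merge-⊗ (idˡ ⟩⊗⟨ cancelˡ α∘α⁻¹)) ⟩
      (id b ⊗₁ ((id c ⊗₁ swap₁₂ d e f) ∘ α c d (e ⊗₀ f))) ∘ α b (c ⊗₀ d) (e ⊗₀ f)
        ≈⟨ split-⊗ʳ ⟩∘⟨refl ⟩
      ((id b ⊗₁ (id c ⊗₁ swap₁₂ d e f)) ∘ (id b ⊗₁ α c d (e ⊗₀ f))) ∘ α b (c ⊗₀ d) (e ⊗₀ f)
        ≈⟨ assoc _ _ _ ⟩
      (id b ⊗₁ (id c ⊗₁ swap₁₂ d e f)) ∘ ((id b ⊗₁ α c d (e ⊗₀ f)) ∘ α b (c ⊗₀ d) (e ⊗₀ f)) ∎

  α-swap₁₂-nf : ∀ b c d e f → (id (c ⊗₀ e) ⊗₁ α b d f) ∘ (α⁻¹ c e ((b ⊗₀ d) ⊗₀ f) ∘ ((id c ⊗₁ swap₁₂ (b ⊗₀ d) e f)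
                        ∘ (α c (b ⊗₀ d) (e ⊗₀ f) ∘ (swap₁₂ b c d ⊗₁ id (e ⊗₀ f))))) ≈ interchange-α-nf b c d e f
  α-swap₁₂-nf b c d e f = begin
    (id (c ⊗₀ e) ⊗₁ α b d f) ∘ (α⁻¹ c e ((b ⊗₀ d) ⊗₀ f) ∘ ((id c ⊗₁ swap₁₂ (b ⊗₀ d) e f) ∘ W))
      ≈⟨ extendˡ (≈.trans ((≈.sym id⊗id ⟩⊗⟨ ≈.refl) ⟩∘⟨refl) (≈.sym α⁻¹-nat)) ⟩
    α⁻¹ c e (b ⊗₀ (d ⊗₀ f)) ∘ ((id c ⊗₁ (id e ⊗₁ α b d f)) ∘ ((id c ⊗₁ swap₁₂ (b ⊗₀ d) e f) ∘ W))
      ≈⟨ refl⟩∘⟨ pullˡ (≈.trans merge-⊗ (idˡ ⟩⊗⟨ (refl⟩∘⟨ swap₁₂-⊗₁ b d e f))) ⟩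
    α⁻¹ c e (b ⊗₀ (d ⊗₀ f)) ∘ ((id c ⊗₁ ((id e ⊗₁ α b d f) ∘ ((id e ⊗₁ α⁻¹ b d f) ∘ Y))) ∘ W)
      ≈⟨ refl⟩∘⟨ ((≈.refl ⟩⊗⟨ cancelˡ (id⊗-inverse α∘α⁻¹)) ⟩∘⟨refl) ⟩
    α⁻¹ c e (b ⊗₀ (d ⊗₀ f)) ∘ ((id c ⊗₁ Y) ∘ W)
      ≈⟨ refl⟩∘⟨ ((≈.trans split-⊗ʳ (refl⟩∘⟨ split-⊗ʳ)) ⟩∘⟨refl) ⟩
    α⁻¹ c e (b ⊗₀ (d ⊗₀ f)) ∘ (((id c ⊗₁ swap₁₂ b e (d ⊗₀ f)) ∘ ((id c ⊗₁ (id b ⊗₁ swap₁₂ d e f)) ∘ (id c ⊗₁ α b d (e ⊗₀ f)))) ∘ W)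
      ≈⟨ refl⟩∘⟨ ≈.trans (assoc _ _ _) (refl⟩∘⟨ assoc _ _ _) ⟩
    interchange-α-nf b c d e f ∎
    where
    W : Hom ((b ⊗₀ (c ⊗₀ d)) ⊗₀ (e ⊗₀ f)) (c ⊗₀ ((b ⊗₀ d) ⊗₀ (e ⊗₀ f)))
    W = α c (b ⊗₀ d) (e ⊗₀ f) ∘ (swap₁₂ b c d ⊗₁ id (e ⊗₀ f))
    Y : Hom ((b ⊗₀ d) ⊗₀ (e ⊗₀ f)) (e ⊗₀ (b ⊗₀ (d ⊗₀ f)))
    Y = swap₁₂ b e (d ⊗₀ f) ∘ ((id b ⊗₁ swap₁₂ d e f) ∘ α b d (e ⊗₀ f))

  reassoc : ∀ a b c d e f → Hom (((a ⊗₀ b) ⊗₀ (c ⊗₀ d)) ⊗₀ (e ⊗₀ f)) (a ⊗₀ ((b ⊗₀ (c ⊗₀ d)) ⊗₀ (e ⊗₀ f)))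
  reassoc a b c d e f = α a (b ⊗₀ (c ⊗₀ d)) (e ⊗₀ f) ∘ (α a b (c ⊗₀ d) ⊗₁ id (e ⊗₀ f))

  interchange-α-lhs : ∀ a b c d e f → interchange a b (c ⊗₀ e) (d ⊗₀ f) ∘ ((id (a ⊗₀ b) ⊗₁ interchange c d e f) ∘ α (a ⊗₀ b) (c ⊗₀ d) (e ⊗₀ f))
          ≈ α⁻¹ a (c ⊗₀ e) (b ⊗₀ (d ⊗₀ f)) ∘ ((id a ⊗₁ interchange-α-nf b c d e f) ∘ reassoc a b c d e f)
  interchange-α-lhs a b c d e f = begin
    (α⁻¹ a (c ⊗₀ e) (b ⊗₀ (d ⊗₀ f)) ∘ ((id a ⊗₁ swap₁₂ b (c ⊗₀ e) (d ⊗₀ f)) ∘ α a b ((c ⊗₀ e) ⊗₀ (d ⊗₀ f))))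
      ∘ ((id (a ⊗₀ b) ⊗₁ interchange c d e f) ∘ α (a ⊗₀ b) (c ⊗₀ d) (e ⊗₀ f))
      ≈⟨ pullʳ (pullʳ (sym-assoc _ _ _)) ⟩
    α⁻¹ a (c ⊗₀ e) (b ⊗₀ (d ⊗₀ f)) ∘ ((id a ⊗₁ swap₁₂ b (c ⊗₀ e) (d ⊗₀ f)) ∘ ((α a b ((c ⊗₀ e) ⊗₀ (d ⊗₀ f))
      ∘ (id (a ⊗₀ b) ⊗₁ interchange c d e f)) ∘ α (a ⊗₀ b) (c ⊗₀ d) (e ⊗₀ f)))
      ≈⟨ refl⟩∘⟨ refl⟩∘⟨ ((≈.trans (refl⟩∘⟨ (≈.sym id⊗id ⟩⊗⟨ ≈.refl)) α-nat) ⟩∘⟨refl) ⟩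
    α⁻¹ a (c ⊗₀ e) (b ⊗₀ (d ⊗₀ f)) ∘ ((id a ⊗₁ swap₁₂ b (c ⊗₀ e) (d ⊗₀ f)) ∘ (((id a ⊗₁ (id b ⊗₁ interchange c d e f))
      ∘ α a b ((c ⊗₀ d) ⊗₀ (e ⊗₀ f))) ∘ α (a ⊗₀ b) (c ⊗₀ d) (e ⊗₀ f)))
      ≈⟨ refl⟩∘⟨ refl⟩∘⟨ pullʳ (≈.sym (pentagon a b (c ⊗₀ d) (e ⊗₀ f))) ⟩
    α⁻¹ a (c ⊗₀ e) (b ⊗₀ (d ⊗₀ f)) ∘ ((id a ⊗₁ swap₁₂ b (c ⊗₀ e) (d ⊗₀ f)) ∘ ((id a ⊗₁ (id b ⊗₁ interchange c d e f))
      ∘ ((id a ⊗₁ α b (c ⊗₀ d) (e ⊗₀ f)) ∘ reassoc a b c d e f)))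
      ≈⟨ refl⟩∘⟨ ≈.trans (≈.trans (refl⟩∘⟨ sym-assoc _ _ _) (sym-assoc _ _ _)) (≈.sym split-⊗ʳ₃ ⟩∘⟨refl) ⟩
    α⁻¹ a (c ⊗₀ e) (b ⊗₀ (d ⊗₀ f)) ∘ ((id a ⊗₁ (swap₁₂ b (c ⊗₀ e) (d ⊗₀ f) ∘ ((id b ⊗₁ interchange c d e f) ∘ α b (c ⊗₀ d) (e ⊗₀ f))))
      ∘ reassoc a b c d e f)
      ≈⟨ refl⟩∘⟨ ((≈.refl ⟩⊗⟨ swap₁₂-interchange-nf b c d e f) ⟩∘⟨refl) ⟩
    α⁻¹ a (c ⊗₀ e) (b ⊗₀ (d ⊗₀ f)) ∘ ((id a ⊗₁ interchange-α-nf b c d e f) ∘ reassoc a b c d e f) ∎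

  interchange-α-rhs : ∀ a b c d e f → (α a c e ⊗₁ α b d f) ∘ (interchange (a ⊗₀ c) (b ⊗₀ d) e f ∘ (interchange a b c d ⊗₁ id (e ⊗₀ f)))
          ≈ α⁻¹ a (c ⊗₀ e) (b ⊗₀ (d ⊗₀ f)) ∘ ((id a ⊗₁ interchange-α-nf b c d e f) ∘ reassoc a b c d e f)
  interchange-α-rhs a b c d e f = begin
    (α a c e ⊗₁ α b d f) ∘ ((α⁻¹ (a ⊗₀ c) e ((b ⊗₀ d) ⊗₀ f) ∘ ((id (a ⊗₀ c) ⊗₁ swap₁₂ (b ⊗₀ d) e f) ∘ α (a ⊗₀ c) (b ⊗₀ d) (e ⊗₀ f)))
       ∘ (interchange a b c d ⊗₁ id (e ⊗₀ f)))
      ≈⟨ serialize₂₁ ⟩∘⟨ assoc₃ ⟩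
    ((id (a ⊗₀ (c ⊗₀ e)) ⊗₁ α b d f) ∘ (α a c e ⊗₁ id ((b ⊗₀ d) ⊗₀ f))) ∘ (α⁻¹ (a ⊗₀ c) e ((b ⊗₀ d) ⊗₀ f)
       ∘ ((id (a ⊗₀ c) ⊗₁ swap₁₂ (b ⊗₀ d) e f) ∘ (α (a ⊗₀ c) (b ⊗₀ d) (e ⊗₀ f) ∘ (interchange a b c d ⊗₁ id (e ⊗₀ f)))))
      ≈⟨ pullʳ (≈.trans (pullˡ (pentagon-α⊗id∘α⁻¹ a c e ((b ⊗₀ d) ⊗₀ f))) assoc₃) ⟩
    (id (a ⊗₀ (c ⊗₀ e)) ⊗₁ α b d f) ∘ (α⁻¹ a (c ⊗₀ e) ((b ⊗₀ d) ⊗₀ f) ∘ ((id a ⊗₁ α⁻¹ c e ((b ⊗₀ d) ⊗₀ f))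
       ∘ (α a c (e ⊗₀ ((b ⊗₀ d) ⊗₀ f)) ∘ ((id (a ⊗₀ c) ⊗₁ swap₁₂ (b ⊗₀ d) e f) ∘ (α (a ⊗₀ c) (b ⊗₀ d) (e ⊗₀ f) ∘ (interchange a b c d ⊗₁ id (e ⊗₀ f)))))))
      ≈⟨ extendˡ (≈.trans ((≈.sym id⊗id ⟩⊗⟨ ≈.refl) ⟩∘⟨refl) (≈.sym α⁻¹-nat)) ⟩
    α⁻¹ a (c ⊗₀ e) (b ⊗₀ (d ⊗₀ f)) ∘ ((id a ⊗₁ (id (c ⊗₀ e) ⊗₁ α b d f)) ∘ ((id a ⊗₁ α⁻¹ c e ((b ⊗₀ d) ⊗₀ f))
       ∘ (α a c (e ⊗₀ ((b ⊗₀ d) ⊗₀ f)) ∘ ((id (a ⊗₀ c) ⊗₁ swap₁₂ (b ⊗₀ d) e f) ∘ (α (a ⊗₀ c) (b ⊗₀ d) (e ⊗₀ f) ∘ (interchange a b c d ⊗₁ id (e ⊗₀ f)))))))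
      ≈⟨ refl⟩∘⟨ refl⟩∘⟨ refl⟩∘⟨ extendˡ (≈.trans (refl⟩∘⟨ (≈.sym id⊗id ⟩⊗⟨ ≈.refl)) α-nat) ⟩
    α⁻¹ a (c ⊗₀ e) (b ⊗₀ (d ⊗₀ f)) ∘ ((id a ⊗₁ (id (c ⊗₀ e) ⊗₁ α b d f)) ∘ ((id a ⊗₁ α⁻¹ c e ((b ⊗₀ d) ⊗₀ f))
       ∘ ((id a ⊗₁ (id c ⊗₁ swap₁₂ (b ⊗₀ d) e f)) ∘ (α a c ((b ⊗₀ d) ⊗₀ (e ⊗₀ f)) ∘ (α (a ⊗₀ c) (b ⊗₀ d) (e ⊗₀ f) ∘ (interchange a b c d ⊗₁ id (e ⊗₀ f)))))))
      ≈⟨ refl⟩∘⟨ refl⟩∘⟨ refl⟩∘⟨ refl⟩∘⟨ α∘α∘interchange⊗id ⟩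
    α⁻¹ a (c ⊗₀ e) (b ⊗₀ (d ⊗₀ f)) ∘ ((id a ⊗₁ (id (c ⊗₀ e) ⊗₁ α b d f)) ∘ ((id a ⊗₁ α⁻¹ c e ((b ⊗₀ d) ⊗₀ f))
       ∘ ((id a ⊗₁ (id c ⊗₁ swap₁₂ (b ⊗₀ d) e f)) ∘ ((id a ⊗₁ α c (b ⊗₀ d) (e ⊗₀ f)) ∘ ((id a ⊗₁ (swap₁₂ b c d ⊗₁ id (e ⊗₀ f))) ∘ reassoc a b c d e f)))))
      ≈⟨ refl⟩∘⟨ ≈.trans (split-⊗ʳ₅ ⟩∘⟨refl) assoc₅ ⟨
    α⁻¹ a (c ⊗₀ e) (b ⊗₀ (d ⊗₀ f)) ∘ ((id a ⊗₁ ((id (c ⊗₀ e) ⊗₁ α b d f) ∘ (α⁻¹ c e ((b ⊗₀ d) ⊗₀ f) ∘ ((id c ⊗₁ swap₁₂ (b ⊗₀ d) e f)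
                        ∘ (α c (b ⊗₀ d) (e ⊗₀ f) ∘ (swap₁₂ b c d ⊗₁ id (e ⊗₀ f))))))) ∘ reassoc a b c d e f)
      ≈⟨ refl⟩∘⟨ ((≈.refl ⟩⊗⟨ α-swap₁₂-nf b c d e f) ⟩∘⟨refl) ⟩
    α⁻¹ a (c ⊗₀ e) (b ⊗₀ (d ⊗₀ f)) ∘ ((id a ⊗₁ interchange-α-nf b c d e f) ∘ reassoc a b c d e f) ∎
    where
    α∘α∘interchange⊗id : α a c ((b ⊗₀ d) ⊗₀ (e ⊗₀ f)) ∘ (α (a ⊗₀ c) (b ⊗₀ d) (e ⊗₀ f) ∘ (interchange a b c d ⊗₁ id (e ⊗₀ f)))
           ≈ (id a ⊗₁ α c (b ⊗₀ d) (e ⊗₀ f)) ∘ ((id a ⊗₁ (swap₁₂ b c d ⊗₁ id (e ⊗₀ f))) ∘ reassoc a b c d e f)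
    α∘α∘interchange⊗id = begin
      α a c ((b ⊗₀ d) ⊗₀ (e ⊗₀ f)) ∘ (α (a ⊗₀ c) (b ⊗₀ d) (e ⊗₀ f) ∘ (interchange a b c d ⊗₁ id (e ⊗₀ f)))
        ≈⟨ pullˡ (≈.sym (pentagon a c (b ⊗₀ d) (e ⊗₀ f))) ⟩
      ((id a ⊗₁ α c (b ⊗₀ d) (e ⊗₀ f)) ∘ (α a (c ⊗₀ (b ⊗₀ d)) (e ⊗₀ f) ∘ (α a c (b ⊗₀ d) ⊗₁ id (e ⊗₀ f)))) ∘ (interchange a b c d ⊗₁ id (e ⊗₀ f))
        ≈⟨ assoc₃ ⟩
      (id a ⊗₁ α c (b ⊗₀ d) (e ⊗₀ f)) ∘ (α a (c ⊗₀ (b ⊗₀ d)) (e ⊗₀ f) ∘ ((α a c (b ⊗₀ d) ⊗₁ id (e ⊗₀ f)) ∘ (interchange a b c d ⊗₁ id (e ⊗₀ f))))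
        ≈⟨ refl⟩∘⟨ refl⟩∘⟨ ≈.trans merge-⊗ (≈.trans (cancelˡ α∘α⁻¹ ⟩⊗⟨ idˡ) split-⊗ˡ) ⟩
      (id a ⊗₁ α c (b ⊗₀ d) (e ⊗₀ f)) ∘ (α a (c ⊗₀ (b ⊗₀ d)) (e ⊗₀ f) ∘ ((((id a ⊗₁ swap₁₂ b c d)) ⊗₁ id (e ⊗₀ f)) ∘ (α a b (c ⊗₀ d) ⊗₁ id (e ⊗₀ f))))
        ≈⟨ refl⟩∘⟨ pullˡ α-nat ⟩
      (id a ⊗₁ α c (b ⊗₀ d) (e ⊗₀ f)) ∘ (((id a ⊗₁ (swap₁₂ b c d ⊗₁ id (e ⊗₀ f))) ∘ α a (b ⊗₀ (c ⊗₀ d)) (e ⊗₀ f)) ∘ (α a b (c ⊗₀ d) ⊗₁ id (e ⊗₀ f)))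
        ≈⟨ refl⟩∘⟨ assoc _ _ _ ⟩
      (id a ⊗₁ α c (b ⊗₀ d) (e ⊗₀ f)) ∘ ((id a ⊗₁ (swap₁₂ b c d ⊗₁ id (e ⊗₀ f))) ∘ reassoc a b c d e f) ∎

  interchange-α : ∀ a b c d e f → interchange a b (c ⊗₀ e) (d ⊗₀ f) ∘ ((id (a ⊗₀ b) ⊗₁ interchange c d e f) ∘ α (a ⊗₀ b) (c ⊗₀ d) (e ⊗₀ f))
        ≈ (α a c e ⊗₁ α b d f) ∘ (interchange (a ⊗₀ c) (b ⊗₀ d) e f ∘ (interchange a b c d ⊗₁ id (e ⊗₀ f)))
  interchange-α a b c d e f = ≈.trans (interchange-α-lhs a b c d e f) (≈.sym (interchange-α-rhs a b c d e f))

  α-interchange : ∀ x y z u v → (id x ⊗₁ interchange y z u v) ∘ (α x (y ⊗₀ z) (u ⊗₀ v) ∘ (α x y z ⊗₁ id (u ⊗₀ v)))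
       ≈ α x (y ⊗₀ u) (z ⊗₀ v) ∘ ((α x y u ⊗₁ id (z ⊗₀ v)) ∘ interchange (x ⊗₀ y) z u v)
  α-interchange x y z u v = ≈.sym (begin
    α x (y ⊗₀ u) (z ⊗₀ v) ∘ ((α x y u ⊗₁ id (z ⊗₀ v)) ∘ (α⁻¹ (x ⊗₀ y) u (z ⊗₀ v) ∘ ((id (x ⊗₀ y) ⊗₁ swap₁₂ z u v) ∘ α (x ⊗₀ y) z (u ⊗₀ v))))
      ≈⟨ ≈.trans (refl⟩∘⟨ sym-assoc _ _ _) (sym-assoc _ _ _) ⟩
    (α x (y ⊗₀ u) (z ⊗₀ v) ∘ ((α x y u ⊗₁ id (z ⊗₀ v)) ∘ α⁻¹ (x ⊗₀ y) u (z ⊗₀ v))) ∘ ((id (x ⊗₀ y) ⊗₁ swap₁₂ z u v) ∘ α (x ⊗₀ y) z (u ⊗₀ v))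
      ≈⟨ α∘α⊗id∘α⁻¹ ⟩∘⟨refl ⟩
    ((id x ⊗₁ α⁻¹ y u (z ⊗₀ v)) ∘ α x y (u ⊗₀ (z ⊗₀ v))) ∘ ((id (x ⊗₀ y) ⊗₁ swap₁₂ z u v) ∘ α (x ⊗₀ y) z (u ⊗₀ v))
      ≈⟨ pullʳ (pullˡ (≈.trans (refl⟩∘⟨ (≈.sym id⊗id ⟩⊗⟨ ≈.refl)) α-nat)) ⟩
    (id x ⊗₁ α⁻¹ y u (z ⊗₀ v)) ∘ (((id x ⊗₁ (id y ⊗₁ swap₁₂ z u v)) ∘ α x y (z ⊗₀ (u ⊗₀ v))) ∘ α (x ⊗₀ y) z (u ⊗₀ v))
      ≈⟨ refl⟩∘⟨ pullʳ (≈.sym (pentagon x y z (u ⊗₀ v))) ⟩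
    (id x ⊗₁ α⁻¹ y u (z ⊗₀ v)) ∘ ((id x ⊗₁ (id y ⊗₁ swap₁₂ z u v)) ∘ ((id x ⊗₁ α y z (u ⊗₀ v)) ∘ (α x (y ⊗₀ z) (u ⊗₀ v) ∘ (α x y z ⊗₁ id (u ⊗₀ v)))))
      ≈⟨ ≈.trans (≈.trans (refl⟩∘⟨ sym-assoc _ _ _) (sym-assoc _ _ _)) (≈.sym split-⊗ʳ₃ ⟩∘⟨refl) ⟩
    (id x ⊗₁ interchange y z u v) ∘ (α x (y ⊗₀ z) (u ⊗₀ v) ∘ (α x y z ⊗₁ id (u ⊗₀ v))) ∎)
    where
    α∘α⊗id∘α⁻¹ : α x (y ⊗₀ u) (z ⊗₀ v) ∘ ((α x y u ⊗₁ id (z ⊗₀ v)) ∘ α⁻¹ (x ⊗₀ y) u (z ⊗₀ v)) ≈ (id x ⊗₁ α⁻¹ y u (z ⊗₀ v)) ∘ α x y (u ⊗₀ (z ⊗₀ v))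
    α∘α⊗id∘α⁻¹ = begin
      α x (y ⊗₀ u) (z ⊗₀ v) ∘ ((α x y u ⊗₁ id (z ⊗₀ v)) ∘ α⁻¹ (x ⊗₀ y) u (z ⊗₀ v)) ≈⟨ sym-assoc _ _ _ ⟩
      (α x (y ⊗₀ u) (z ⊗₀ v) ∘ (α x y u ⊗₁ id (z ⊗₀ v))) ∘ α⁻¹ (x ⊗₀ y) u (z ⊗₀ v) ≈⟨ pentagon-id⊗α⁻¹ x y u (z ⊗₀ v) ⟩∘⟨refl ⟨
      ((id x ⊗₁ α⁻¹ y u (z ⊗₀ v)) ∘ (α x y (u ⊗₀ (z ⊗₀ v)) ∘ α (x ⊗₀ y) u (z ⊗₀ v))) ∘ α⁻¹ (x ⊗₀ y) u (z ⊗₀ v)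
        ≈⟨ pullʳ (≈.trans (pullʳ α∘α⁻¹) idʳ) ⟩
      (id x ⊗₁ α⁻¹ y u (z ⊗₀ v)) ∘ α x y (u ⊗₀ (z ⊗₀ v)) ∎

module Comonoids {o ℓ e : Level} (𝒢 : GSMonoidal o ℓ e) where
  open GSMonoidal 𝒢
  open Reasoning 𝒢
  open Interchange 𝒢

  Δ-assoc : ∀ {A} → α⇒ ∘ ((Δ ⊗₁ id A) ∘ Δ) ≈ (id A ⊗₁ Δ) ∘ Δ
  Δ-assoc = copy-coassoc _

  Δ-assoc⁻¹ : ∀ {A} → α⇐ ∘ ((id A ⊗₁ Δ) ∘ Δ) ≈ (Δ ⊗₁ id A) ∘ Δ
  Δ-assoc⁻¹ = ≈.trans (refl⟩∘⟨ ≈.sym Δ-assoc) (cancelˡ α⁻¹∘α)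

  Δ-comm : ∀ {A} → σ⇒ ∘ Δ ≈ Δ {A}
  Δ-comm = copy-comm _

  Δ-⊗ : ∀ {A B} → Δ {A ⊗₀ B} ≈ interchange _ _ _ _ ∘ (Δ ⊗₁ Δ)
  Δ-⊗ = ≈.trans (copy-⊗ _ _) (≈.sym (≈.trans (assoc _ _ _) (refl⟩∘⟨ assoc _ _ _)))

  Functional-id : ∀ {A} → Functional (id A)
  Functional-id = ≈.trans idʳ (≈.sym (≈.trans (id⊗id ⟩∘⟨refl) idˡ))

  Functional-∘ : ∀ {A B D} {f : Hom B D} {g : Hom A B} → Functional f → Functional g → Functional (f ∘ g)
  Functional-∘ {f = f} {g} pf pg = begin
    Δ ∘ (f ∘ g) ≈⟨ pullˡ pf ⟩
    ((f ⊗₁ f) ∘ Δ) ∘ g ≈⟨ pullʳ pg ⟩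
    (f ⊗₁ f) ∘ ((g ⊗₁ g) ∘ Δ) ≈⟨ sym-assoc _ _ _ ⟩
    ((f ⊗₁ f) ∘ (g ⊗₁ g)) ∘ Δ ≈⟨ merge-⊗ ⟩∘⟨refl ⟩
    ((f ∘ g) ⊗₁ (f ∘ g)) ∘ Δ ∎

  Functional-⊗ : ∀ {A B D E} {f : Hom A B} {g : Hom D E} → Functional f → Functional g → Functional (f ⊗₁ g)
  Functional-⊗ {f = f} {g} pf pg = begin
    Δ ∘ (f ⊗₁ g) ≈⟨ Δ-⊗ ⟩∘⟨refl ⟩
    (interchange _ _ _ _ ∘ (Δ ⊗₁ Δ)) ∘ (f ⊗₁ g) ≈⟨ pullʳ merge-⊗ ⟩
    interchange _ _ _ _ ∘ ((Δ ∘ f) ⊗₁ (Δ ∘ g)) ≈⟨ refl⟩∘⟨ (pf ⟩⊗⟨ pg) ⟩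
    interchange _ _ _ _ ∘ (((f ⊗₁ f) ∘ Δ) ⊗₁ ((g ⊗₁ g) ∘ Δ)) ≈⟨ refl⟩∘⟨ split-⊗ ⟩
    interchange _ _ _ _ ∘ (((f ⊗₁ f) ⊗₁ (g ⊗₁ g)) ∘ (Δ ⊗₁ Δ)) ≈⟨ pullˡ interchange-natural ⟩
    (((f ⊗₁ g) ⊗₁ (f ⊗₁ g)) ∘ interchange _ _ _ _) ∘ (Δ ⊗₁ Δ) ≈⟨ pullʳ (≈.sym Δ-⊗) ⟩
    ((f ⊗₁ g) ⊗₁ (f ⊗₁ g)) ∘ Δ ∎

  swap₁₂-Δ : ∀ {A} → swap₁₂ _ _ _ ∘ ((id A ⊗₁ Δ) ∘ Δ) ≈ (id A ⊗₁ Δ) ∘ Δ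
  swap₁₂-Δ = begin
    (α⇒ ∘ ((σ⇒ ⊗₁ ι) ∘ α⇐)) ∘ ((ι ⊗₁ Δ) ∘ Δ) ≈⟨ pullʳ (pullʳ Δ-assoc⁻¹) ⟩
    α⇒ ∘ ((σ⇒ ⊗₁ ι) ∘ ((Δ ⊗₁ ι) ∘ Δ)) ≈⟨ refl⟩∘⟨ pullˡ (≈.trans merge-⊗ (Δ-comm ⟩⊗⟨ idˡ)) ⟩
    α⇒ ∘ ((Δ ⊗₁ ι) ∘ Δ) ≈⟨ Δ-assoc ⟩
    (ι ⊗₁ Δ) ∘ Δ ∎

  α∘Δ⊗Δ∘Δ : ∀ {A} → α⇒ ∘ ((Δ ⊗₁ Δ) ∘ Δ) ≈ (id A ⊗₁ (id A ⊗₁ Δ)) ∘ ((id A ⊗₁ Δ) ∘ Δ)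
  α∘Δ⊗Δ∘Δ = begin
    α⇒ ∘ ((Δ ⊗₁ Δ) ∘ Δ) ≈⟨ refl⟩∘⟨ ((≈.trans serialize₂₁ ((≈.sym id⊗id ⟩⊗⟨ ≈.refl) ⟩∘⟨refl)) ⟩∘⟨refl) ⟩
    α⇒ ∘ ((((ι ⊗₁ ι) ⊗₁ Δ) ∘ (Δ ⊗₁ ι)) ∘ Δ) ≈⟨ refl⟩∘⟨ assoc _ _ _ ⟩
    α⇒ ∘ (((ι ⊗₁ ι) ⊗₁ Δ) ∘ ((Δ ⊗₁ ι) ∘ Δ)) ≈⟨ pullˡ α-nat ⟩
    ((ι ⊗₁ (ι ⊗₁ Δ)) ∘ α⇒) ∘ ((Δ ⊗₁ ι) ∘ Δ) ≈⟨ pullʳ Δ-assoc ⟩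
    (ι ⊗₁ (ι ⊗₁ Δ)) ∘ ((ι ⊗₁ Δ) ∘ Δ) ∎

  Functional-Δ : ∀ {A} → Functional (Δ {A})
  Functional-Δ = begin
    Δ ∘ Δ ≈⟨ Δ-⊗ ⟩∘⟨refl ⟩
    (interchange _ _ _ _ ∘ (Δ ⊗₁ Δ)) ∘ Δ ≈⟨ assoc _ _ _ ⟩
    (α⇐ ∘ ((ι ⊗₁ swap₁₂ _ _ _) ∘ α⇒)) ∘ ((Δ ⊗₁ Δ) ∘ Δ) ≈⟨ pullʳ (assoc _ _ _) ⟩
    α⇐ ∘ ((ι ⊗₁ swap₁₂ _ _ _) ∘ (α⇒ ∘ ((Δ ⊗₁ Δ) ∘ Δ))) ≈⟨ refl⟩∘⟨ refl⟩∘⟨ α∘Δ⊗Δ∘Δ ⟩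
    α⇐ ∘ ((ι ⊗₁ swap₁₂ _ _ _) ∘ ((ι ⊗₁ (ι ⊗₁ Δ)) ∘ ((ι ⊗₁ Δ) ∘ Δ))) ≈⟨ refl⟩∘⟨ inner ⟩
    α⇐ ∘ ((ι ⊗₁ (ι ⊗₁ Δ)) ∘ ((ι ⊗₁ Δ) ∘ Δ)) ≈⟨ refl⟩∘⟨ α∘Δ⊗Δ∘Δ ⟨
    α⇐ ∘ (α⇒ ∘ ((Δ ⊗₁ Δ) ∘ Δ)) ≈⟨ cancelˡ α⁻¹∘α ⟩
    (Δ ⊗₁ Δ) ∘ Δ ∎
    where
    inner : (ι ⊗₁ swap₁₂ _ _ _) ∘ ((ι ⊗₁ (ι ⊗₁ Δ)) ∘ ((ι ⊗₁ Δ) ∘ Δ)) ≈ (ι ⊗₁ (ι ⊗₁ Δ)) ∘ ((ι ⊗₁ Δ) ∘ Δ)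
    inner = begin
      (ι ⊗₁ swap₁₂ _ _ _) ∘ ((ι ⊗₁ (ι ⊗₁ Δ)) ∘ ((ι ⊗₁ Δ) ∘ Δ)) ≈⟨ pullˡ (≈.sym split-⊗ʳ) ⟩
      (ι ⊗₁ (swap₁₂ _ _ _ ∘ (ι ⊗₁ Δ))) ∘ ((ι ⊗₁ Δ) ∘ Δ) ≈⟨ pullˡ (≈.sym split-⊗ʳ) ⟩
      (ι ⊗₁ ((swap₁₂ _ _ _ ∘ (ι ⊗₁ Δ)) ∘ Δ)) ∘ Δ ≈⟨ (≈.refl ⟩⊗⟨ assoc _ _ _) ⟩∘⟨refl ⟩
      (ι ⊗₁ (swap₁₂ _ _ _ ∘ ((ι ⊗₁ Δ) ∘ Δ))) ∘ Δ ≈⟨ (≈.refl ⟩⊗⟨ swap₁₂-Δ) ⟩∘⟨refl ⟩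
      (ι ⊗₁ ((ι ⊗₁ Δ) ∘ Δ)) ∘ Δ ≈⟨ split-⊗ʳ ⟩∘⟨refl ⟩
      ((ι ⊗₁ (ι ⊗₁ Δ)) ∘ (ι ⊗₁ Δ)) ∘ Δ ≈⟨ assoc _ _ _ ⟩
      (ι ⊗₁ (ι ⊗₁ Δ)) ∘ ((ι ⊗₁ Δ) ∘ Δ) ∎

  Functional-α : ∀ x y z → Functional (α x y z)
  Functional-α x y z = begin
    copy _ ∘ α x y z ≈⟨ Δ-⊗ ⟩∘⟨refl ⟩
    (interchange x x (y ⊗₀ z) (y ⊗₀ z) ∘ (copy x ⊗₁ copy (y ⊗₀ z))) ∘ α x y z ≈⟨ pullʳ ((≈.refl ⟩⊗⟨ Δ-⊗) ⟩∘⟨refl) ⟩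
    interchange x x (y ⊗₀ z) (y ⊗₀ z) ∘ ((copy x ⊗₁ (interchange y y z z ∘ (copy y ⊗₁ copy z))) ∘ α x y z)
      ≈⟨ refl⟩∘⟨ ((≈.trans (≈.sym idˡ ⟩⊗⟨ ≈.refl) split-⊗) ⟩∘⟨refl) ⟩
    interchange x x (y ⊗₀ z) (y ⊗₀ z) ∘ (((id _ ⊗₁ interchange y y z z) ∘ (copy x ⊗₁ (copy y ⊗₁ copy z))) ∘ α x y z)
      ≈⟨ refl⟩∘⟨ pullʳ (≈.sym α-nat) ⟩
    interchange x x (y ⊗₀ z) (y ⊗₀ z) ∘ ((id _ ⊗₁ interchange y y z z) ∘ (α (x ⊗₀ x) (y ⊗₀ y) (z ⊗₀ z) ∘ ((copy x ⊗₁ copy y) ⊗₁ copy z)))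
      ≈⟨ refl⟩∘⟨ sym-assoc _ _ _ ⟩
    interchange x x (y ⊗₀ z) (y ⊗₀ z) ∘ (((id _ ⊗₁ interchange y y z z) ∘ α (x ⊗₀ x) (y ⊗₀ y) (z ⊗₀ z)) ∘ ((copy x ⊗₁ copy y) ⊗₁ copy z))
      ≈⟨ sym-assoc _ _ _ ⟩
    (interchange x x (y ⊗₀ z) (y ⊗₀ z) ∘ ((id _ ⊗₁ interchange y y z z) ∘ α (x ⊗₀ x) (y ⊗₀ y) (z ⊗₀ z))) ∘ ((copy x ⊗₁ copy y) ⊗₁ copy z)
      ≈⟨ interchange-α x x y y z z ⟩∘⟨refl ⟩
    ((α x y z ⊗₁ α x y z) ∘ (interchange (x ⊗₀ y) (x ⊗₀ y) z z ∘ (interchange x x y y ⊗₁ id (z ⊗₀ z)))) ∘ ((copy x ⊗₁ copy y) ⊗₁ copy z)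
      ≈⟨ pullʳ (pullʳ (≈.trans merge-⊗ (≈.sym Δ-⊗ ⟩⊗⟨ idˡ))) ⟩
    (α x y z ⊗₁ α x y z) ∘ (interchange (x ⊗₀ y) (x ⊗₀ y) z z ∘ (copy (x ⊗₀ y) ⊗₁ copy z))
      ≈⟨ refl⟩∘⟨ Δ-⊗ ⟨
    (α x y z ⊗₁ α x y z) ∘ copy _ ∎

module Forks {o ℓ e : Level} (𝒢 : GSMonoidal o ℓ e) where
  open GSMonoidal 𝒢
  open Reasoning 𝒢
  open Associators 𝒢
  open Unitors 𝒢
  open Interchange 𝒢
  open Comonoids 𝒢

  dup : ∀ P X → Hom (P ⊗₀ X) (P ⊗₀ (P ⊗₀ X))
  dup P X = α P P X ∘ (copy P ⊗₁ id X)

  -- IsSimulator P s says that s ≈ fork sT sC with sT functional.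
  fork : ∀ {P X Y Z} → Hom P Y → Hom (P ⊗₀ X) Z → Hom (P ⊗₀ X) (Y ⊗₀ Z)
  fork {P} {X} a c = (a ⊗₁ c) ∘ dup P X

  discard : ∀ {P} X → Hom P I → Hom (P ⊗₀ X) X
  discard X d = unitˡ X ∘ (d ⊗₁ id X)

  Functional-dup : ∀ P X → Functional (dup P X)
  Functional-dup P X = Functional-∘ (Functional-α P P X) (Functional-⊗ Functional-Δ Functional-id)

  fork-resp-≈ : ∀ {P X Y Z} {a a' : Hom P Y} {c c' : Hom (P ⊗₀ X) Z} → a ≈ a' → c ≈ c' → fork a c ≈ fork a' c'
  fork-resp-≈ pa pc = (pa ⟩⊗⟨ pc) ⟩∘⟨refl

  ⊗∘fork : ∀ {P X Y Z Y' Z'} {h : Hom Y Y'} {k : Hom Z Z'} {a : Hom P Y} {c : Hom (P ⊗₀ X) Z} →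
       (h ⊗₁ k) ∘ fork a c ≈ fork (h ∘ a) (k ∘ c)
  ⊗∘fork = pullˡ merge-⊗

  fork∘⊗id : ∀ {P P' X Y Z} {a : Hom P Y} {c : Hom (P ⊗₀ X) Z} {g : Hom P' P} → Functional g →
       fork a c ∘ (g ⊗₁ id X) ≈ fork (a ∘ g) (c ∘ (g ⊗₁ id X))
  fork∘⊗id {a = a} {c} {g} fg = begin
    ((a ⊗₁ c) ∘ (α _ _ _ ∘ (copy _ ⊗₁ id _))) ∘ (g ⊗₁ id _) ≈⟨ pullʳ (pullʳ merge-⊗) ⟩
    (a ⊗₁ c) ∘ (α _ _ _ ∘ ((copy _ ∘ g) ⊗₁ (id _ ∘ id _))) ≈⟨ refl⟩∘⟨ refl⟩∘⟨ (fg ⟩⊗⟨ ≈.trans idˡ (≈.sym idˡ)) ⟩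
    (a ⊗₁ c) ∘ (α _ _ _ ∘ (((g ⊗₁ g) ∘ copy _) ⊗₁ (id _ ∘ id _))) ≈⟨ refl⟩∘⟨ refl⟩∘⟨ split-⊗ ⟩
    (a ⊗₁ c) ∘ (α _ _ _ ∘ (((g ⊗₁ g) ⊗₁ id _) ∘ (copy _ ⊗₁ id _))) ≈⟨ refl⟩∘⟨ pullˡ α-nat ⟩
    (a ⊗₁ c) ∘ ((g ⊗₁ (g ⊗₁ id _)) ∘ α _ _ _) ∘ (copy _ ⊗₁ id _) ≈⟨ refl⟩∘⟨ assoc _ _ _ ⟩
    (a ⊗₁ c) ∘ ((g ⊗₁ (g ⊗₁ id _)) ∘ (α _ _ _ ∘ (copy _ ⊗₁ id _))) ≈⟨ pullˡ merge-⊗ ⟩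
    fork (a ∘ g) (c ∘ (g ⊗₁ id _)) ∎

  dup-coassoc : ∀ {P X} → α P P (P ⊗₀ X) ∘ ((copy P ⊗₁ id (P ⊗₀ X)) ∘ dup P X) ≈ (id P ⊗₁ dup P X) ∘ dup P X
  dup-coassoc {P} {X} = ≈.sym (begin
    (id P ⊗₁ (α P P X ∘ (copy P ⊗₁ id X))) ∘ (α P P X ∘ (copy P ⊗₁ id X))
      ≈⟨ split-⊗ʳ ⟩∘⟨refl ⟩
    ((id P ⊗₁ α P P X) ∘ (id P ⊗₁ (copy P ⊗₁ id X))) ∘ (α P P X ∘ (copy P ⊗₁ id X))
      ≈⟨ pullʳ (pullˡ α-nat₂₃) ⟩
    (id P ⊗₁ α P P X) ∘ ((α P (P ⊗₀ P) X ∘ ((id P ⊗₁ copy P) ⊗₁ id X)) ∘ (copy P ⊗₁ id X))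
      ≈⟨ refl⟩∘⟨ pullʳ (≈.trans (≈.sym split-⊗ˡ) ((≈.sym Δ-assoc) ⟩⊗⟨ ≈.refl)) ⟩
    (id P ⊗₁ α P P X) ∘ (α P (P ⊗₀ P) X ∘ ((α P P P ∘ ((copy P ⊗₁ id P) ∘ copy P)) ⊗₁ id X))
      ≈⟨ refl⟩∘⟨ refl⟩∘⟨ split-⊗ˡ ⟩
    (id P ⊗₁ α P P X) ∘ (α P (P ⊗₀ P) X ∘ ((α P P P ⊗₁ id X) ∘ (((copy P ⊗₁ id P) ∘ copy P) ⊗₁ id X)))
      ≈⟨ ≈.trans (refl⟩∘⟨ sym-assoc _ _ _) (sym-assoc _ _ _) ⟩
    ((id P ⊗₁ α P P X) ∘ (α P (P ⊗₀ P) X ∘ (α P P P ⊗₁ id X))) ∘ (((copy P ⊗₁ id P) ∘ copy P) ⊗₁ id X)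
      ≈⟨ pentagon P P P X ⟩∘⟨ split-⊗ˡ ⟩
    (α P P (P ⊗₀ X) ∘ α (P ⊗₀ P) P X) ∘ (((copy P ⊗₁ id P) ⊗₁ id X) ∘ (copy P ⊗₁ id X))
      ≈⟨ pullʳ (pullˡ α-nat) ⟩
    α P P (P ⊗₀ X) ∘ ((copy P ⊗₁ (id P ⊗₁ id X)) ∘ α P P X) ∘ (copy P ⊗₁ id X)
      ≈⟨ refl⟩∘⟨ ≈.trans (assoc _ _ _) (((≈.refl ⟩⊗⟨ id⊗id)) ⟩∘⟨refl) ⟩
    α P P (P ⊗₀ X) ∘ ((copy P ⊗₁ id (P ⊗₀ X)) ∘ (α P P X ∘ (copy P ⊗₁ id X))) ∎)

  fork∘fork : ∀ {P X Y Z W} {a : Hom P Y} {c : Hom (P ⊗₀ W) Z} {n : Hom P P} {d : Hom (P ⊗₀ X) W} → Functional n →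
          fork a c ∘ fork n d ≈ fork (a ∘ n) (c ∘ fork n d)
  fork∘fork {P} {X} {a = a} {c} {n} {d} fn = begin
    ((a ⊗₁ c) ∘ (α P P _ ∘ (copy P ⊗₁ id _))) ∘ ((n ⊗₁ d) ∘ (α P P X ∘ (copy P ⊗₁ id X)))
      ≈⟨ pullʳ (pullʳ (pullˡ merge-⊗)) ⟩
    (a ⊗₁ c) ∘ (α P P _ ∘ (((copy P ∘ n) ⊗₁ (id _ ∘ d)) ∘ (α P P X ∘ (copy P ⊗₁ id X))))
      ≈⟨ refl⟩∘⟨ refl⟩∘⟨ ((fn ⟩⊗⟨ ≈.trans idˡ (≈.sym idʳ)) ⟩∘⟨refl) ⟩
    (a ⊗₁ c) ∘ (α P P _ ∘ ((((n ⊗₁ n) ∘ copy P) ⊗₁ (d ∘ id _)) ∘ (α P P X ∘ (copy P ⊗₁ id X))))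
      ≈⟨ refl⟩∘⟨ refl⟩∘⟨ (split-⊗ ⟩∘⟨refl) ⟩
    (a ⊗₁ c) ∘ (α P P _ ∘ ((((n ⊗₁ n) ⊗₁ d) ∘ (copy P ⊗₁ id _)) ∘ (α P P X ∘ (copy P ⊗₁ id X))))
      ≈⟨ refl⟩∘⟨ refl⟩∘⟨ assoc _ _ _ ⟩
    (a ⊗₁ c) ∘ (α P P _ ∘ (((n ⊗₁ n) ⊗₁ d) ∘ ((copy P ⊗₁ id _) ∘ (α P P X ∘ (copy P ⊗₁ id X)))))
      ≈⟨ refl⟩∘⟨ extendˡ α-nat ⟩
    (a ⊗₁ c) ∘ ((n ⊗₁ (n ⊗₁ d)) ∘ (α P P _ ∘ ((copy P ⊗₁ id _) ∘ (α P P X ∘ (copy P ⊗₁ id X)))))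
      ≈⟨ pullˡ merge-⊗ ⟩
    ((a ∘ n) ⊗₁ (c ∘ (n ⊗₁ d))) ∘ (α P P _ ∘ ((copy P ⊗₁ id _) ∘ (α P P X ∘ (copy P ⊗₁ id X))))
      ≈⟨ refl⟩∘⟨ dup-coassoc ⟩
    ((a ∘ n) ⊗₁ (c ∘ (n ⊗₁ d))) ∘ ((id P ⊗₁ (α P P X ∘ (copy P ⊗₁ id X))) ∘ (α P P X ∘ (copy P ⊗₁ id X)))
      ≈⟨ pullˡ (≈.trans merge-⊗ (idʳ ⟩⊗⟨ assoc _ _ _)) ⟩
    fork (a ∘ n) (c ∘ fork n d) ∎

  id⊗Δ∘dup : ∀ P X → (id P ⊗₁ copy (P ⊗₀ X)) ∘ dup P X ≈ α P (P ⊗₀ X) (P ⊗₀ X) ∘ ((dup P X ⊗₁ id (P ⊗₀ X)) ∘ copy (P ⊗₀ X))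
  id⊗Δ∘dup P X = begin
    (id P ⊗₁ copy (P ⊗₀ X)) ∘ (α P P X ∘ (copy P ⊗₁ id X))
      ≈⟨ ((≈.refl ⟩⊗⟨ Δ-⊗) ⟩∘⟨refl) ⟩
    (id P ⊗₁ (interchange P P X X ∘ (copy P ⊗₁ copy X))) ∘ (α P P X ∘ (copy P ⊗₁ id X))
      ≈⟨ split-⊗ʳ ⟩∘⟨refl ⟩
    ((id P ⊗₁ interchange P P X X) ∘ (id P ⊗₁ (copy P ⊗₁ copy X))) ∘ (α P P X ∘ (copy P ⊗₁ id X))
      ≈⟨ pullʳ (pullˡ α-nat₂₃) ⟩
    (id P ⊗₁ interchange P P X X) ∘ ((α P (P ⊗₀ P) (X ⊗₀ X) ∘ ((id P ⊗₁ copy P) ⊗₁ copy X)) ∘ (copy P ⊗₁ id X))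
      ≈⟨ refl⟩∘⟨ pullʳ (≈.trans merge-⊗ ((≈.sym Δ-assoc) ⟩⊗⟨ idʳ)) ⟩
    (id P ⊗₁ interchange P P X X) ∘ (α P (P ⊗₀ P) (X ⊗₀ X) ∘ ((α P P P ∘ ((copy P ⊗₁ id P) ∘ copy P)) ⊗₁ copy X))
      ≈⟨ refl⟩∘⟨ refl⟩∘⟨ ≈.trans (≈.refl ⟩⊗⟨ ≈.sym idˡ) split-⊗ ⟩
    (id P ⊗₁ interchange P P X X) ∘ (α P (P ⊗₀ P) (X ⊗₀ X) ∘ ((α P P P ⊗₁ id _) ∘ (((copy P ⊗₁ id P) ∘ copy P) ⊗₁ copy X)))
      ≈⟨ ≈.trans (refl⟩∘⟨ sym-assoc _ _ _) (sym-assoc _ _ _) ⟩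
    ((id P ⊗₁ interchange P P X X) ∘ (α P (P ⊗₀ P) (X ⊗₀ X) ∘ (α P P P ⊗₁ id _))) ∘ (((copy P ⊗₁ id P) ∘ copy P) ⊗₁ copy X)
      ≈⟨ α-interchange P P P X X ⟩∘⟨refl ⟩
    (α P (P ⊗₀ X) (P ⊗₀ X) ∘ ((α P P X ⊗₁ id (P ⊗₀ X)) ∘ interchange (P ⊗₀ P) P X X)) ∘ (((copy P ⊗₁ id P) ∘ copy P) ⊗₁ copy X)
      ≈⟨ assoc₃ ⟩
    α P (P ⊗₀ X) (P ⊗₀ X) ∘ ((α P P X ⊗₁ id (P ⊗₀ X)) ∘ (interchange (P ⊗₀ P) P X X ∘ (((copy P ⊗₁ id P) ∘ copy P) ⊗₁ copy X)))
      ≈⟨ refl⟩∘⟨ refl⟩∘⟨ refl⟩∘⟨ ≈.trans (≈.refl ⟩⊗⟨ ≈.trans (≈.sym idˡ) (≈.sym id⊗id ⟩∘⟨refl)) split-⊗ ⟩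
    α P (P ⊗₀ X) (P ⊗₀ X) ∘ ((α P P X ⊗₁ id (P ⊗₀ X)) ∘ (interchange (P ⊗₀ P) P X X ∘ (((copy P ⊗₁ id P) ⊗₁ (id X ⊗₁ id X)) ∘ (copy P ⊗₁ copy X))))
      ≈⟨ refl⟩∘⟨ refl⟩∘⟨ pullˡ interchange-natural ⟩
    α P (P ⊗₀ X) (P ⊗₀ X) ∘ ((α P P X ⊗₁ id (P ⊗₀ X)) ∘ (((copy P ⊗₁ id X) ⊗₁ (id P ⊗₁ id X)) ∘ interchange P P X X) ∘ (copy P ⊗₁ copy X))
      ≈⟨ refl⟩∘⟨ refl⟩∘⟨ ≈.trans (assoc _ _ _) (((≈.refl ⟩⊗⟨ id⊗id) ⟩∘⟨refl)) ⟩
    α P (P ⊗₀ X) (P ⊗₀ X) ∘ ((α P P X ⊗₁ id (P ⊗₀ X)) ∘ (((copy P ⊗₁ id X) ⊗₁ id (P ⊗₀ X)) ∘ (interchange P P X X ∘ (copy P ⊗₁ copy X))))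
      ≈⟨ refl⟩∘⟨ pullˡ (≈.sym split-⊗ˡ) ⟩
    α P (P ⊗₀ X) (P ⊗₀ X) ∘ ((dup P X ⊗₁ id (P ⊗₀ X)) ∘ (interchange P P X X ∘ (copy P ⊗₁ copy X)))
      ≈⟨ refl⟩∘⟨ refl⟩∘⟨ Δ-⊗ ⟨
    α P (P ⊗₀ X) (P ⊗₀ X) ∘ ((dup P X ⊗₁ id (P ⊗₀ X)) ∘ copy (P ⊗₀ X)) ∎

  fork-dup : ∀ {P X W Y Z} (A : Hom (P ⊗₀ X) Y) (g : Hom ((P ⊗₀ X) ⊗₀ W) Z) →
       α⁻¹ P Y Z ∘ ((id P ⊗₁ fork A g) ∘ (α P (P ⊗₀ X) W ∘ (dup P X ⊗₁ id W))) ≈ fork ((id P ⊗₁ A) ∘ dup P X) g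
  fork-dup {P} {X} {W} {Y} {Z} A g = begin
    α⁻¹ P Y Z ∘ ((id P ⊗₁ ((A ⊗₁ g) ∘ (α Q Q W ∘ (copy Q ⊗₁ id W)))) ∘ (α P Q W ∘ (dup P X ⊗₁ id W)))
      ≈⟨ refl⟩∘⟨ (split-⊗ʳ₃ ⟩∘⟨refl) ⟩
    α⁻¹ P Y Z ∘ (((id P ⊗₁ (A ⊗₁ g)) ∘ ((id P ⊗₁ α Q Q W) ∘ (id P ⊗₁ (copy Q ⊗₁ id W)))) ∘ (α P Q W ∘ (dup P X ⊗₁ id W)))
      ≈⟨ refl⟩∘⟨ ≈.trans assoc₃ (refl⟩∘⟨ refl⟩∘⟨ pullˡ α-nat₂₃) ⟩
    α⁻¹ P Y Z ∘ ((id P ⊗₁ (A ⊗₁ g)) ∘ ((id P ⊗₁ α Q Q W) ∘ ((α P (Q ⊗₀ Q) W ∘ ((id P ⊗₁ copy Q) ⊗₁ id W)) ∘ (dup P X ⊗₁ id W))))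
      ≈⟨ refl⟩∘⟨ refl⟩∘⟨ refl⟩∘⟨ pullʳ (≈.trans (≈.sym split-⊗ˡ) ((id⊗Δ∘dup P X ⟩⊗⟨ ≈.refl))) ⟩
    α⁻¹ P Y Z ∘ ((id P ⊗₁ (A ⊗₁ g)) ∘ ((id P ⊗₁ α Q Q W) ∘ (α P (Q ⊗₀ Q) W ∘ ((α P Q Q ∘ ((dup P X ⊗₁ id Q) ∘ copy Q)) ⊗₁ id W))))
      ≈⟨ refl⟩∘⟨ refl⟩∘⟨ refl⟩∘⟨ refl⟩∘⟨ ≈.trans split-⊗ˡ (refl⟩∘⟨ split-⊗ˡ) ⟩
    α⁻¹ P Y Z ∘ ((id P ⊗₁ (A ⊗₁ g)) ∘ ((id P ⊗₁ α Q Q W) ∘ (α P (Q ⊗₀ Q) W ∘ ((α P Q Q ⊗₁ id W) ∘ (((dup P X ⊗₁ id Q) ⊗₁ id W) ∘ (copy Q ⊗₁ id W))))))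
      ≈⟨ refl⟩∘⟨ refl⟩∘⟨ ≈.trans (≈.trans (refl⟩∘⟨ sym-assoc _ _ _) (sym-assoc _ _ _)) (pentagon P Q Q W ⟩∘⟨refl) ⟩
    α⁻¹ P Y Z ∘ ((id P ⊗₁ (A ⊗₁ g)) ∘ ((α P Q (Q ⊗₀ W) ∘ α (P ⊗₀ Q) Q W) ∘ (((dup P X ⊗₁ id Q) ⊗₁ id W) ∘ (copy Q ⊗₁ id W))))
      ≈⟨ refl⟩∘⟨ refl⟩∘⟨ pullʳ (pullˡ (≈.trans α-nat ((≈.refl ⟩⊗⟨ id⊗id) ⟩∘⟨refl))) ⟩
    α⁻¹ P Y Z ∘ ((id P ⊗₁ (A ⊗₁ g)) ∘ (α P Q (Q ⊗₀ W) ∘ (((dup P X ⊗₁ id (Q ⊗₀ W)) ∘ α Q Q W) ∘ (copy Q ⊗₁ id W))))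
      ≈⟨ pullˡ α⁻¹-nat ⟩
    (((id P ⊗₁ A) ⊗₁ g) ∘ α⁻¹ P Q (Q ⊗₀ W)) ∘ (α P Q (Q ⊗₀ W) ∘ (((dup P X ⊗₁ id (Q ⊗₀ W)) ∘ α Q Q W) ∘ (copy Q ⊗₁ id W)))
      ≈⟨ pullʳ (cancelˡ α⁻¹∘α) ⟩
    ((id P ⊗₁ A) ⊗₁ g) ∘ (((dup P X ⊗₁ id (Q ⊗₀ W)) ∘ α Q Q W) ∘ (copy Q ⊗₁ id W))
      ≈⟨ refl⟩∘⟨ assoc _ _ _ ⟩
    ((id P ⊗₁ A) ⊗₁ g) ∘ ((dup P X ⊗₁ id (Q ⊗₀ W)) ∘ (α Q Q W ∘ (copy Q ⊗₁ id W)))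
      ≈⟨ pullˡ (≈.trans merge-⊗ (≈.refl ⟩⊗⟨ idʳ)) ⟩
    fork ((id P ⊗₁ A) ∘ dup P X) g ∎
    where
    Q : Obj
    Q = P ⊗₀ X

  id⊗α⁻¹∘dup∘α : ∀ P Y Z → (id P ⊗₁ α⁻¹ P Y Z) ∘ (α P P (Y ⊗₀ Z) ∘ ((copy P ⊗₁ id (Y ⊗₀ Z)) ∘ α P Y Z))
                 ≈ α P (P ⊗₀ Y) Z ∘ (dup P Y ⊗₁ id Z)
  id⊗α⁻¹∘dup∘α P Y Z = begin
    (id P ⊗₁ α⁻¹ P Y Z) ∘ (α P P (Y ⊗₀ Z) ∘ ((copy P ⊗₁ id (Y ⊗₀ Z)) ∘ α P Y Z))
      ≈⟨ refl⟩∘⟨ refl⟩∘⟨ α-nat₁ ⟩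
    (id P ⊗₁ α⁻¹ P Y Z) ∘ (α P P (Y ⊗₀ Z) ∘ (α (P ⊗₀ P) Y Z ∘ ((copy P ⊗₁ id Y) ⊗₁ id Z)))
      ≈⟨ ≈.trans (refl⟩∘⟨ sym-assoc _ _ _) (sym-assoc _ _ _) ⟩
    ((id P ⊗₁ α⁻¹ P Y Z) ∘ (α P P (Y ⊗₀ Z) ∘ α (P ⊗₀ P) Y Z)) ∘ ((copy P ⊗₁ id Y) ⊗₁ id Z)
      ≈⟨ pentagon-id⊗α⁻¹ P P Y Z ⟩∘⟨refl ⟩
    (α P (P ⊗₀ Y) Z ∘ (α P P Y ⊗₁ id Z)) ∘ ((copy P ⊗₁ id Y) ⊗₁ id Z)
      ≈⟨ pullʳ (≈.sym split-⊗ˡ) ⟩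
    α P (P ⊗₀ Y) Z ∘ (dup P Y ⊗₁ id Z) ∎

  dup-counit : ∀ P X → unitˡ (P ⊗₀ X) ∘ ((del P ⊗₁ id (P ⊗₀ X)) ∘ dup P X) ≈ id (P ⊗₀ X)
  dup-counit P X = begin
    unitˡ (P ⊗₀ X) ∘ ((del P ⊗₁ id (P ⊗₀ X)) ∘ (α P P X ∘ (copy P ⊗₁ id X)))
      ≈⟨ refl⟩∘⟨ pullˡ (≈.trans ((≈.refl ⟩⊗⟨ ≈.sym id⊗id) ⟩∘⟨refl) (≈.sym α-nat)) ⟩
    unitˡ (P ⊗₀ X) ∘ ((α I P X ∘ ((del P ⊗₁ id P) ⊗₁ id X)) ∘ (copy P ⊗₁ id X))
      ≈⟨ refl⟩∘⟨ assoc _ _ _ ⟩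
    unitˡ (P ⊗₀ X) ∘ (α I P X ∘ (((del P ⊗₁ id P) ⊗₁ id X) ∘ (copy P ⊗₁ id X)))
      ≈⟨ pullˡ unitˡ-α ⟩
    (unitˡ P ⊗₁ id X) ∘ (((del P ⊗₁ id P) ⊗₁ id X) ∘ (copy P ⊗₁ id X))
      ≈⟨ refl⟩∘⟨ merge-⊗ ⟩
    (unitˡ P ⊗₁ id X) ∘ (((del P ⊗₁ id P) ∘ copy P) ⊗₁ (id X ∘ id X))
      ≈⟨ merge-⊗ ⟩
    (unitˡ P ∘ ((del P ⊗₁ id P) ∘ copy P)) ⊗₁ (id X ∘ (id X ∘ id X))
      ≈⟨ ((refl⟩∘⟨ copy-counitˡ P) ⟩⊗⟨ ≈.trans idˡ idˡ) ⟩
    (unitˡ P ∘ unitˡ⁻¹ P) ⊗₁ id X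
      ≈⟨ (unitˡ-isoʳ P ⟩⊗⟨ ≈.refl) ⟩
    id P ⊗₁ id X ≈⟨ id⊗id ⟩
    id (P ⊗₀ X) ∎

  discard∘fork-id : ∀ {P X Y} (f : Hom (P ⊗₀ X) Y) → unitˡ Y ∘ ((del P ⊗₁ id Y) ∘ fork (id P) f) ≈ f
  discard∘fork-id {P} {X} {Y} f = begin
    unitˡ Y ∘ ((del P ⊗₁ id Y) ∘ ((id P ⊗₁ f) ∘ dup P X))
      ≈⟨ refl⟩∘⟨ pullˡ (≈.trans merge-⊗ (≈.trans (≈.trans idʳ (≈.sym idˡ) ⟩⊗⟨ ≈.trans idˡ (≈.sym idʳ)) split-⊗)) ⟩
    unitˡ Y ∘ (((id I ⊗₁ f) ∘ (del P ⊗₁ id (P ⊗₀ X))) ∘ dup P X)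
      ≈⟨ ≈.trans (refl⟩∘⟨ assoc _ _ _) (pullˡ λ-nat) ⟩
    (f ∘ unitˡ (P ⊗₀ X)) ∘ ((del P ⊗₁ id (P ⊗₀ X)) ∘ dup P X)
      ≈⟨ ≈.trans (pullʳ (dup-counit P X)) idʳ ⟩
    f ∎

  swap₁₂-discard : ∀ {P} X (d : Hom P I) →
    unitʳ X ∘ ((id X ⊗₁ (unitˡ I ∘ (d ⊗₁ del X))) ∘ swap₁₂ P X X) ≈ unitˡ X ∘ (d ⊗₁ (unitʳ X ∘ (id X ⊗₁ del X)))
  swap₁₂-discard {P} X d = begin
    unitʳ X ∘ ((id X ⊗₁ (unitˡ I ∘ (d ⊗₁ del X))) ∘ (α X P X ∘ ((σ P X ⊗₁ id X) ∘ α⁻¹ P X X)))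
      ≈⟨ refl⟩∘⟨ (split-⊗ʳ ⟩∘⟨refl) ⟩
    unitʳ X ∘ (((id X ⊗₁ unitˡ I) ∘ (id X ⊗₁ (d ⊗₁ del X))) ∘ (α X P X ∘ ((σ P X ⊗₁ id X) ∘ α⁻¹ P X X)))
      ≈⟨ refl⟩∘⟨ pullʳ (pullˡ (≈.sym α-nat)) ⟩
    unitʳ X ∘ ((id X ⊗₁ unitˡ I) ∘ ((α X I I ∘ ((id X ⊗₁ d) ⊗₁ del X)) ∘ ((σ P X ⊗₁ id X) ∘ α⁻¹ P X X)))
      ≈⟨ refl⟩∘⟨ ≈.trans (refl⟩∘⟨ assoc _ _ _) (pullˡ (triangle X I)) ⟩
    unitʳ X ∘ ((unitʳ X ⊗₁ id I) ∘ (((id X ⊗₁ d) ⊗₁ del X) ∘ ((σ P X ⊗₁ id X) ∘ α⁻¹ P X X)))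
      ≈⟨ pullˡ ρ-nat ⟩
    (unitʳ X ∘ unitʳ (X ⊗₀ I)) ∘ (((id X ⊗₁ d) ⊗₁ del X) ∘ ((σ P X ⊗₁ id X) ∘ α⁻¹ P X X))
      ≈⟨ refl⟩∘⟨ pullˡ (≈.trans merge-⊗ ((≈.sym σ-nat) ⟩⊗⟨ idʳ)) ⟩
    (unitʳ X ∘ unitʳ (X ⊗₀ I)) ∘ (((σ I X ∘ (d ⊗₁ id X)) ⊗₁ del X) ∘ α⁻¹ P X X)
      ≈⟨ refl⟩∘⟨ (serialize₁₂ ⟩∘⟨refl) ⟩
    (unitʳ X ∘ unitʳ (X ⊗₀ I)) ∘ ((((σ I X ∘ (d ⊗₁ id X)) ⊗₁ id I) ∘ (id _ ⊗₁ del X)) ∘ α⁻¹ P X X)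
      ≈⟨ pullʳ (≈.trans (refl⟩∘⟨ assoc _ _ _) (pullˡ ρ-nat)) ⟩
    unitʳ X ∘ ((σ I X ∘ (d ⊗₁ id X)) ∘ unitʳ (P ⊗₀ X)) ∘ ((id _ ⊗₁ del X) ∘ α⁻¹ P X X)
      ≈⟨ ≈.trans (refl⟩∘⟨ ≈.trans (assoc _ _ _) (assoc _ _ _)) (pullˡ unitʳ-σ) ⟩
    unitˡ X ∘ ((d ⊗₁ id X) ∘ (unitʳ (P ⊗₀ X) ∘ ((id _ ⊗₁ del X) ∘ α⁻¹ P X X)))
      ≈⟨ refl⟩∘⟨ refl⟩∘⟨ refl⟩∘⟨ ≈.trans ((≈.sym id⊗id ⟩⊗⟨ ≈.refl) ⟩∘⟨refl) (≈.sym α⁻¹-nat) ⟩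
    unitˡ X ∘ ((d ⊗₁ id X) ∘ (unitʳ (P ⊗₀ X) ∘ (α⁻¹ P X I ∘ (id P ⊗₁ (id X ⊗₁ del X)))))
      ≈⟨ refl⟩∘⟨ refl⟩∘⟨ pullˡ (unitʳ-α⁻¹ P X) ⟩
    unitˡ X ∘ ((d ⊗₁ id X) ∘ ((id P ⊗₁ unitʳ X) ∘ (id P ⊗₁ (id X ⊗₁ del X))))
      ≈⟨ refl⟩∘⟨ refl⟩∘⟨ ≈.trans merge-⊗ (idˡ ⟩⊗⟨ ≈.refl) ⟩
    unitˡ X ∘ ((d ⊗₁ id X) ∘ (id P ⊗₁ (unitʳ X ∘ (id X ⊗₁ del X))))
      ≈⟨ refl⟩∘⟨ ≈.trans merge-⊗ (idʳ ⟩⊗⟨ idˡ) ⟩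
    unitˡ X ∘ (d ⊗₁ (unitʳ X ∘ (id X ⊗₁ del X))) ∎

  dom-discard : ∀ {P} X (d : Hom P I) → dom (discard X d) ≈ fork (id P) (discard X d)
  dom-discard {P} X d = begin
    unitʳ (P ⊗₀ X) ∘ ((id (P ⊗₀ X) ⊗₁ (del X ∘ (unitˡ X ∘ (d ⊗₁ id X)))) ∘ copy (P ⊗₀ X))
      ≈⟨ refl⟩∘⟨ ((≈.refl ⟩⊗⟨ hh) ⟩∘⟨ Δ-⊗) ⟩
    unitʳ (P ⊗₀ X) ∘ ((id (P ⊗₀ X) ⊗₁ h') ∘ (interchange _ _ _ _ ∘ (copy P ⊗₁ copy X)))
      ≈⟨ refl⟩∘⟨ refl⟩∘⟨ assoc₃ ⟩
    unitʳ (P ⊗₀ X) ∘ ((id (P ⊗₀ X) ⊗₁ h') ∘ (α⁻¹ P X (P ⊗₀ X) ∘ ((id P ⊗₁ swap₁₂ _ _ _) ∘ (α P P (X ⊗₀ X) ∘ (copy P ⊗₁ copy X)))))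
      ≈⟨ refl⟩∘⟨ pullˡ (≈.trans ((≈.sym id⊗id ⟩⊗⟨ ≈.refl) ⟩∘⟨refl) (≈.sym α⁻¹-nat)) ⟩
    unitʳ (P ⊗₀ X) ∘ ((α⁻¹ P X I ∘ (id P ⊗₁ (id X ⊗₁ h'))) ∘ ((id P ⊗₁ swap₁₂ _ _ _) ∘ (α P P (X ⊗₀ X) ∘ (copy P ⊗₁ copy X))))
      ≈⟨ pullˡ (≈.trans (sym-assoc _ _ _) (unitʳ-α⁻¹ P X ⟩∘⟨refl)) ⟩
    ((id P ⊗₁ unitʳ X) ∘ (id P ⊗₁ (id X ⊗₁ h'))) ∘ ((id P ⊗₁ swap₁₂ _ _ _) ∘ (α P P (X ⊗₀ X) ∘ (copy P ⊗₁ copy X)))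
      ≈⟨ assoc _ _ _ ⟩
    (id P ⊗₁ unitʳ X) ∘ ((id P ⊗₁ (id X ⊗₁ h')) ∘ ((id P ⊗₁ swap₁₂ _ _ _) ∘ (α P P (X ⊗₀ X) ∘ (copy P ⊗₁ copy X))))
      ≈⟨ ≈.trans (≈.trans (refl⟩∘⟨ sym-assoc _ _ _) (sym-assoc _ _ _)) (≈.trans (≈.trans (refl⟩∘⟨ merge-⊗) merge-⊗) (≈.trans idˡ idˡ ⟩⊗⟨ swap₁₂-discard X d) ⟩∘⟨refl) ⟩
    (id P ⊗₁ (unitˡ X ∘ (d ⊗₁ (unitʳ X ∘ (id X ⊗₁ del X))))) ∘ (α P P (X ⊗₀ X) ∘ (copy P ⊗₁ copy X))
      ≈⟨ refl⟩∘⟨ refl⟩∘⟨ ≈.trans serialize₂₁ ((≈.sym id⊗id ⟩⊗⟨ ≈.refl) ⟩∘⟨refl) ⟩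
    (id P ⊗₁ (unitˡ X ∘ (d ⊗₁ (unitʳ X ∘ (id X ⊗₁ del X))))) ∘ (α P P (X ⊗₀ X) ∘ (((id P ⊗₁ id P) ⊗₁ copy X) ∘ (copy P ⊗₁ id X)))
      ≈⟨ refl⟩∘⟨ extendˡ α-nat ⟩
    (id P ⊗₁ (unitˡ X ∘ (d ⊗₁ (unitʳ X ∘ (id X ⊗₁ del X))))) ∘ ((id P ⊗₁ (id P ⊗₁ copy X)) ∘ (α P P X ∘ (copy P ⊗₁ id X)))
      ≈⟨ pullˡ (≈.trans merge-⊗ (idˡ ⟩⊗⟨ pullʳ (≈.trans merge-⊗ (idʳ ⟩⊗⟨ pullʳ (copy-counitʳ X))))) ⟩
    (id P ⊗₁ (unitˡ X ∘ (d ⊗₁ (unitʳ X ∘ unitʳ⁻¹ X)))) ∘ (α P P X ∘ (copy P ⊗₁ id X))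
      ≈⟨ (≈.refl ⟩⊗⟨ (refl⟩∘⟨ (≈.refl ⟩⊗⟨ unitʳ-isoʳ X))) ⟩∘⟨refl ⟩
    (id P ⊗₁ (unitˡ X ∘ (d ⊗₁ id X))) ∘ (α P P X ∘ (copy P ⊗₁ id X)) ∎
    where
    h' : Hom (P ⊗₀ X) I
    h' = unitˡ I ∘ (d ⊗₁ del X)
    hh : del X ∘ (unitˡ X ∘ (d ⊗₁ id X)) ≈ h'
    hh = begin
      del X ∘ (unitˡ X ∘ (d ⊗₁ id X)) ≈⟨ ≈.trans (pullˡ λ-nat) (assoc _ _ _) ⟨
      unitˡ I ∘ ((id I ⊗₁ del X) ∘ (d ⊗₁ id X)) ≈⟨ refl⟩∘⟨ ≈.trans merge-⊗ (idˡ ⟩⊗⟨ idʳ) ⟩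
      h' ∎

  discard-dom : ∀ {P} X (d : Hom P I) → discard X (del P) ∘ dom (discard X d) ≈ discard X d
  discard-dom X d = begin
    discard X (del _) ∘ dom (discard X d)                   ≈⟨ refl⟩∘⟨ dom-discard X d ⟩
    discard X (del _) ∘ fork (id _) (discard X d)           ≈⟨ assoc _ _ _ ⟩
    unitˡ X ∘ ((del _ ⊗₁ id X) ∘ fork (id _) (discard X d)) ≈⟨ discard∘fork-id (discard X d) ⟩
    discard X d                                             ∎

module Composition {o ℓ e p : Level} (𝒞 : TargetContext o ℓ e p) where
  open Simulators 𝒞
  open Reasoning gs
  open Comonoids gs
  open Forks gs

  ≽-trans : ∀ {A} {f g h : Hom A (T ⊗₀ C)} → f ≽ g → g ≽ h → f ≽ h
  ≽-trans = IsPreorder.trans ≽-preorder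

  ≈⇒≽ : ∀ {A} {f g : Hom A (T ⊗₀ C)} → f ≈ g → f ≽ g
  ≈⇒≽ = IsPreorder.reflexive ≽-preorder

  module Composite
    {P P₁ P₂ : Obj}
    (s : Hom (P ⊗₀ C) (T ⊗₀ C)) (s₁ : Hom (P₁ ⊗₀ C) (T ⊗₀ C)) (s₂ : Hom (P₂ ⊗₀ C) (T ⊗₀ C))
    (r₁ : Hom P₁ P) (r₂ : Hom P₂ P₁) (r₂-functional : Functional r₂)
    (q₁ : Hom ((P₁ ⊗₀ T) ⊗₀ C) (T ⊗₀ C)) (a₁ : Hom (P₁ ⊗₀ T) T) (c₁ : Hom ((P₁ ⊗₀ T) ⊗₀ C) C)
    (a₁-functional : Functional a₁)
    (q₁-fork : q₁ ≈ fork a₁ c₁)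
    (q₁-del : (id T ⊗₁ del C) ∘ q₁ ≈ a₁ ⊗₁ del C)
    (q₁-bounded : (unitˡ (T ⊗₀ C) ∘ ((del P₁ ⊗₁ id (T ⊗₀ C)) ∘ α P₁ T C)) ≽ q₁)
    (s₁-processed : s₁ ≈ q₁ ∘ (α⁻¹ P₁ T C ∘ fork (id P₁) (s ∘ (r₁ ⊗₁ id C))))
    (q₂ : Hom ((P₂ ⊗₀ T) ⊗₀ C) (T ⊗₀ C)) (a₂ : Hom (P₂ ⊗₀ T) T) (c₂ : Hom ((P₂ ⊗₀ T) ⊗₀ C) C)
    (a₂-functional : Functional a₂)
    (q₂-fork : q₂ ≈ fork a₂ c₂)
    (q₂-del : (id T ⊗₁ del C) ∘ q₂ ≈ a₂ ⊗₁ del C)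
    (q₂-context : unitˡ C ∘ ((del T ⊗₁ id C) ∘ q₂) ≈ c₂)
    (q₂-bounded : (unitˡ (T ⊗₀ C) ∘ ((del P₂ ⊗₁ id (T ⊗₀ C)) ∘ α P₂ T C)) ≽ q₂)
    (s₂-processed : s₂ ≈ q₂ ∘ (α⁻¹ P₂ T C ∘ fork (id P₂) (s₁ ∘ (r₂ ⊗₁ id C))))
    where

    X : Obj
    X = T ⊗₀ C

    S : Hom (P₂ ⊗₀ C) X
    S = s ∘ ((r₁ ∘ r₂) ⊗₁ id C)

    q₁r₂ : Hom (P₂ ⊗₀ X) X
    q₁r₂ = q₁ ∘ (α⁻¹ P₁ T C ∘ (r₂ ⊗₁ id X))

    stage₁ : Hom ((P₂ ⊗₀ T) ⊗₀ C) ((P₂ ⊗₀ T) ⊗₀ C)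
    stage₁ = α⁻¹ P₂ T C ∘ ((id P₂ ⊗₁ q₁r₂) ∘ (α P₂ P₂ X ∘ ((copy P₂ ⊗₁ id X) ∘ α P₂ T C)))

    q : Hom ((P₂ ⊗₀ T) ⊗₀ C) X
    q = compProcessing P₁ P₂ r₂ q₁ q₂

    a₁′ : Hom (P₂ ⊗₀ T) T
    a₁′ = a₁ ∘ (r₂ ⊗₁ id T)

    c₁′ : Hom ((P₂ ⊗₀ T) ⊗₀ C) C
    c₁′ = c₁ ∘ ((r₂ ⊗₁ id T) ⊗₁ id C)

    retarget : Hom (P₂ ⊗₀ T) (P₂ ⊗₀ T)
    retarget = (id P₂ ⊗₁ a₁′) ∘ dup P₂ T

    r₂⊗id-functional : Functional (r₂ ⊗₁ id T)
    r₂⊗id-functional = Functional-⊗ r₂-functional Functional-id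

    retarget-functional : Functional retarget
    retarget-functional =
      Functional-∘ (Functional-⊗ Functional-id (Functional-∘ a₁-functional r₂⊗id-functional)) (Functional-dup P₂ T)

    q₁r₂≈fork : q₁r₂ ≈ fork a₁′ c₁′ ∘ α⁻¹ P₂ T C
    q₁r₂≈fork = begin
      q₁ ∘ (α⁻¹ P₁ T C ∘ (r₂ ⊗₁ id X))                ≈⟨ q₁-fork ⟩∘⟨ (refl⟩∘⟨ (≈.refl ⟩⊗⟨ ≈.sym id⊗id)) ⟩
      fork a₁ c₁ ∘ (α⁻¹ P₁ T C ∘ (r₂ ⊗₁ (id T ⊗₁ id C))) ≈⟨ refl⟩∘⟨ α⁻¹-nat ⟩
      fork a₁ c₁ ∘ (((r₂ ⊗₁ id T) ⊗₁ id C) ∘ α⁻¹ P₂ T C) ≈⟨ sym-assoc _ _ _ ⟩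
      (fork a₁ c₁ ∘ ((r₂ ⊗₁ id T) ⊗₁ id C)) ∘ α⁻¹ P₂ T C ≈⟨ fork∘⊗id r₂⊗id-functional ⟩∘⟨refl ⟩
      fork a₁′ c₁′ ∘ α⁻¹ P₂ T C                       ∎

    stage₁≈fork : stage₁ ≈ fork retarget c₁′
    stage₁≈fork = begin
      α⁻¹ P₂ T C ∘ ((id P₂ ⊗₁ q₁r₂) ∘ (α P₂ P₂ X ∘ ((copy P₂ ⊗₁ id X) ∘ α P₂ T C)))
        ≈⟨ refl⟩∘⟨ (((≈.refl ⟩⊗⟨ q₁r₂≈fork) ⟩∘⟨refl)) ⟩
      α⁻¹ P₂ T C ∘ ((id P₂ ⊗₁ (fork a₁′ c₁′ ∘ α⁻¹ P₂ T C)) ∘ (α P₂ P₂ X ∘ ((copy P₂ ⊗₁ id X) ∘ α P₂ T C)))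
        ≈⟨ refl⟩∘⟨ ((split-⊗ʳ ⟩∘⟨refl)) ⟩
      α⁻¹ P₂ T C ∘ (((id P₂ ⊗₁ fork a₁′ c₁′) ∘ (id P₂ ⊗₁ α⁻¹ P₂ T C)) ∘ (α P₂ P₂ X ∘ ((copy P₂ ⊗₁ id X) ∘ α P₂ T C)))
        ≈⟨ refl⟩∘⟨ pullʳ (id⊗α⁻¹∘dup∘α P₂ T C) ⟩
      α⁻¹ P₂ T C ∘ ((id P₂ ⊗₁ fork a₁′ c₁′) ∘ (α P₂ (P₂ ⊗₀ T) C ∘ (dup P₂ T ⊗₁ id C)))
        ≈⟨ fork-dup a₁′ c₁′ ⟩
      fork retarget c₁′ ∎

    q≈fork : q ≈ fork (a₂ ∘ retarget) (c₂ ∘ stage₁)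
    q≈fork = begin
      q₂ ∘ stage₁                                     ≈⟨ q₂-fork ⟩∘⟨ stage₁≈fork ⟩
      fork a₂ c₂ ∘ fork retarget c₁′                  ≈⟨ fork∘fork retarget-functional ⟩
      fork (a₂ ∘ retarget) (c₂ ∘ fork retarget c₁′)   ≈⟨ fork-resp-≈ ≈.refl (refl⟩∘⟨ stage₁≈fork) ⟨
      fork (a₂ ∘ retarget) (c₂ ∘ stage₁)              ∎

    fork-retarget-del : fork retarget (del C ∘ c₁′) ≈ retarget ⊗₁ del C
    fork-retarget-del = begin
      fork retarget (del C ∘ c₁′)
        ≈⟨ fork-dup a₁′ (del C ∘ c₁′) ⟨
      α⁻¹ P₂ T I ∘ ((id P₂ ⊗₁ fork a₁′ (del C ∘ c₁′)) ∘ (α P₂ (P₂ ⊗₀ T) C ∘ (dup P₂ T ⊗₁ id C)))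
        ≈⟨ refl⟩∘⟨ ((≈.refl ⟩⊗⟨ fork-a₁′-del) ⟩∘⟨refl) ⟩
      α⁻¹ P₂ T I ∘ ((id P₂ ⊗₁ (a₁′ ⊗₁ del C)) ∘ (α P₂ (P₂ ⊗₀ T) C ∘ (dup P₂ T ⊗₁ id C)))
        ≈⟨ pullˡ α⁻¹-nat ⟩
      (((id P₂ ⊗₁ a₁′) ⊗₁ del C) ∘ α⁻¹ P₂ (P₂ ⊗₀ T) C) ∘ (α P₂ (P₂ ⊗₀ T) C ∘ (dup P₂ T ⊗₁ id C))
        ≈⟨ pullʳ (cancelˡ α⁻¹∘α) ⟩
      ((id P₂ ⊗₁ a₁′) ⊗₁ del C) ∘ (dup P₂ T ⊗₁ id C)
        ≈⟨ ≈.trans merge-⊗ (≈.refl ⟩⊗⟨ idʳ) ⟩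
      retarget ⊗₁ del C ∎
      where
      fork-a₁′-del : fork a₁′ (del C ∘ c₁′) ≈ a₁′ ⊗₁ del C
      fork-a₁′-del = begin
        fork a₁′ (del C ∘ c₁′)                                ≈⟨ fork-resp-≈ ≈.refl (sym-assoc _ _ _) ⟩
        fork a₁′ ((del C ∘ c₁) ∘ ((r₂ ⊗₁ id T) ⊗₁ id C))      ≈⟨ fork∘⊗id r₂⊗id-functional ⟨
        fork a₁ (del C ∘ c₁) ∘ ((r₂ ⊗₁ id T) ⊗₁ id C)         ≈⟨ ≈.trans ⊗∘fork (fork-resp-≈ idˡ ≈.refl) ⟩∘⟨refl ⟨
        ((id T ⊗₁ del C) ∘ fork a₁ c₁) ∘ ((r₂ ⊗₁ id T) ⊗₁ id C) ≈⟨ (refl⟩∘⟨ q₁-fork) ⟩∘⟨refl ⟨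
        ((id T ⊗₁ del C) ∘ q₁) ∘ ((r₂ ⊗₁ id T) ⊗₁ id C)       ≈⟨ q₁-del ⟩∘⟨refl ⟩
        (a₁ ⊗₁ del C) ∘ ((r₂ ⊗₁ id T) ⊗₁ id C)                ≈⟨ ≈.trans merge-⊗ (≈.refl ⟩⊗⟨ idʳ) ⟩
        a₁′ ⊗₁ del C                                          ∎

    q-del : (id T ⊗₁ del C) ∘ q ≈ (a₂ ∘ retarget) ⊗₁ del C
    q-del = begin
      (id T ⊗₁ del C) ∘ (q₂ ∘ stage₁)             ≈⟨ sym-assoc _ _ _ ⟩
      ((id T ⊗₁ del C) ∘ q₂) ∘ stage₁             ≈⟨ q₂-del ⟩∘⟨ stage₁≈fork ⟩
      (a₂ ⊗₁ del C) ∘ fork retarget c₁′           ≈⟨ ⊗∘fork ⟩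
      fork (a₂ ∘ retarget) (del C ∘ c₁′)          ≈⟨ ≈.trans ⊗∘fork (fork-resp-≈ ≈.refl idˡ) ⟨
      (a₂ ⊗₁ id I) ∘ fork retarget (del C ∘ c₁′)  ≈⟨ refl⟩∘⟨ fork-retarget-del ⟩
      (a₂ ⊗₁ id I) ∘ (retarget ⊗₁ del C)          ≈⟨ ≈.trans merge-⊗ (≈.refl ⟩⊗⟨ idˡ) ⟩
      (a₂ ∘ retarget) ⊗₁ del C                    ∎

    q-context : unitˡ C ∘ ((del T ⊗₁ id C) ∘ q) ≈ c₂ ∘ stage₁
    q-context = begin
      unitˡ C ∘ ((del T ⊗₁ id C) ∘ (q₂ ∘ stage₁)) ≈⟨ ≈.trans (refl⟩∘⟨ sym-assoc _ _ _) (sym-assoc _ _ _) ⟩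
      (unitˡ C ∘ ((del T ⊗₁ id C) ∘ q₂)) ∘ stage₁ ≈⟨ q₂-context ⟩∘⟨refl ⟩
      c₂ ∘ stage₁                                 ∎

    q-isSimulator : IsSimulator (P₂ ⊗₀ T) q
    q-isSimulator =
      a₂ ∘ retarget , c₂ ∘ stage₁ , Functional-∘ a₂-functional retarget-functional , q≈fork , q-del , q-context

    q-bounded : (unitˡ X ∘ ((del P₂ ⊗₁ id X) ∘ α P₂ T C)) ≽ q
    q-bounded =
      ≽-trans del₂≽del₁r₂ (≽-trans del₁r₂≽q₁r₂ (≽-trans (≈⇒≽ (≈.sym discard∘stage₁)) (≽-precomp _ _ stage₁ q₂-bounded)))
      where
      del₂≽del₁r₂ : (unitˡ X ∘ ((del P₂ ⊗₁ id X) ∘ α P₂ T C)) ≽ (discard X (del P₁ ∘ r₂) ∘ α P₂ T C)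
      del₂≽del₁r₂ =
        ≽-trans (≈⇒≽ (sym-assoc _ _ _)) (≽-precomp _ _ (α P₂ T C) (≽-dom _ _ (discard-dom X (del P₁ ∘ r₂))))

      del₁r₂≽q₁r₂ : (discard X (del P₁ ∘ r₂) ∘ α P₂ T C) ≽ (q₁r₂ ∘ α P₂ T C)
      del₁r₂≽q₁r₂ =
        ≽-trans (≈⇒≽ (≈.sym discard∘r₂)) (≽-trans (≽-precomp _ _ r₂′ q₁-bounded) (≈⇒≽ (≈.trans (refl⟩∘⟨ sym-assoc _ _ _) (sym-assoc _ _ _))))
        where
        r₂′ : Hom ((P₂ ⊗₀ T) ⊗₀ C) ((P₁ ⊗₀ T) ⊗₀ C)
        r₂′ = α⁻¹ P₁ T C ∘ ((r₂ ⊗₁ id X) ∘ α P₂ T C)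

        discard∘r₂ : (unitˡ X ∘ ((del P₁ ⊗₁ id X) ∘ α P₁ T C)) ∘ r₂′ ≈ discard X (del P₁ ∘ r₂) ∘ α P₂ T C
        discard∘r₂ = begin
          (unitˡ X ∘ ((del P₁ ⊗₁ id X) ∘ α P₁ T C)) ∘ (α⁻¹ P₁ T C ∘ ((r₂ ⊗₁ id X) ∘ α P₂ T C))
            ≈⟨ pullʳ (pullʳ (cancelˡ α∘α⁻¹)) ⟩
          unitˡ X ∘ ((del P₁ ⊗₁ id X) ∘ ((r₂ ⊗₁ id X) ∘ α P₂ T C))
            ≈⟨ refl⟩∘⟨ pullˡ (≈.trans merge-⊗ (≈.refl ⟩⊗⟨ idˡ)) ⟩
          unitˡ X ∘ (((del P₁ ∘ r₂) ⊗₁ id X) ∘ α P₂ T C)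
            ≈⟨ sym-assoc _ _ _ ⟩
          discard X (del P₁ ∘ r₂) ∘ α P₂ T C ∎

      discard∘stage₁ : (unitˡ X ∘ ((del P₂ ⊗₁ id X) ∘ α P₂ T C)) ∘ stage₁ ≈ q₁r₂ ∘ α P₂ T C
      discard∘stage₁ = begin
        (unitˡ X ∘ ((del P₂ ⊗₁ id X) ∘ α P₂ T C)) ∘ stage₁
          ≈⟨ pullʳ (pullʳ (cancelˡ α∘α⁻¹)) ⟩
        unitˡ X ∘ ((del P₂ ⊗₁ id X) ∘ ((id P₂ ⊗₁ q₁r₂) ∘ (α P₂ P₂ X ∘ ((copy P₂ ⊗₁ id X) ∘ α P₂ T C))))
          ≈⟨ refl⟩∘⟨ refl⟩∘⟨ ≈.trans (refl⟩∘⟨ sym-assoc _ _ _) (sym-assoc _ _ _) ⟩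
        unitˡ X ∘ ((del P₂ ⊗₁ id X) ∘ (fork (id P₂) q₁r₂ ∘ α P₂ T C))
          ≈⟨ ≈.trans (refl⟩∘⟨ sym-assoc _ _ _) (sym-assoc _ _ _) ⟩
        (unitˡ X ∘ ((del P₂ ⊗₁ id X) ∘ fork (id P₂) q₁r₂)) ∘ α P₂ T C
          ≈⟨ discard∘fork-id q₁r₂ ⟩∘⟨refl ⟩
        q₁r₂ ∘ α P₂ T C ∎

    s₁∘r₂ : s₁ ∘ (r₂ ⊗₁ id C) ≈ q₁r₂ ∘ fork (id P₂) S
    s₁∘r₂ = begin
      s₁ ∘ (r₂ ⊗₁ id C)
        ≈⟨ s₁-processed ⟩∘⟨refl ⟩
      (q₁ ∘ (α⁻¹ P₁ T C ∘ fork (id P₁) (s ∘ (r₁ ⊗₁ id C)))) ∘ (r₂ ⊗₁ id C)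
        ≈⟨ assoc₃ ⟩
      q₁ ∘ (α⁻¹ P₁ T C ∘ (fork (id P₁) (s ∘ (r₁ ⊗₁ id C)) ∘ (r₂ ⊗₁ id C)))
        ≈⟨ refl⟩∘⟨ refl⟩∘⟨ fork∘⊗id r₂-functional ⟩
      q₁ ∘ (α⁻¹ P₁ T C ∘ fork (id P₁ ∘ r₂) ((s ∘ (r₁ ⊗₁ id C)) ∘ (r₂ ⊗₁ id C)))
        ≈⟨ refl⟩∘⟨ refl⟩∘⟨ fork-resp-≈ (≈.trans idˡ (≈.sym idʳ)) (≈.trans (pullʳ (≈.trans merge-⊗ (≈.refl ⟩⊗⟨ idˡ))) (≈.sym idˡ)) ⟩
      q₁ ∘ (α⁻¹ P₁ T C ∘ fork (r₂ ∘ id P₂) (id X ∘ S))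
        ≈⟨ refl⟩∘⟨ refl⟩∘⟨ ⊗∘fork ⟨
      q₁ ∘ (α⁻¹ P₁ T C ∘ ((r₂ ⊗₁ id X) ∘ fork (id P₂) S))
        ≈⟨ ≈.trans (refl⟩∘⟨ sym-assoc _ _ _) (sym-assoc _ _ _) ⟩
      q₁r₂ ∘ fork (id P₂) S ∎

    q-processes : s₂ ≈ q ∘ (α⁻¹ P₂ T C ∘ fork (id P₂) S)
    q-processes = begin
      s₂                                                               ≈⟨ s₂-processed ⟩
      q₂ ∘ (α⁻¹ P₂ T C ∘ fork (id P₂) (s₁ ∘ (r₂ ⊗₁ id C)))             ≈⟨ refl⟩∘⟨ refl⟩∘⟨ fork-resp-≈ ≈.refl s₁∘r₂ ⟩
      q₂ ∘ (α⁻¹ P₂ T C ∘ fork (id P₂) (q₁r₂ ∘ fork (id P₂) S))         ≈⟨ refl⟩∘⟨ refl⟩∘⟨ fork-id∘fork-id ⟨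
      q₂ ∘ (α⁻¹ P₂ T C ∘ (fork (id P₂) q₁r₂ ∘ fork (id P₂) S))         ≈⟨ refl⟩∘⟨ sym-assoc _ _ _ ⟩
      q₂ ∘ ((α⁻¹ P₂ T C ∘ fork (id P₂) q₁r₂) ∘ fork (id P₂) S)         ≈⟨ refl⟩∘⟨ (stage₁∘α⁻¹ ⟩∘⟨refl) ⟨
      q₂ ∘ ((stage₁ ∘ α⁻¹ P₂ T C) ∘ fork (id P₂) S)                    ≈⟨ ≈.trans (refl⟩∘⟨ assoc _ _ _) (sym-assoc _ _ _) ⟩
      q ∘ (α⁻¹ P₂ T C ∘ fork (id P₂) S)                                ∎
      where
      fork-id∘fork-id : fork (id P₂) q₁r₂ ∘ fork (id P₂) S ≈ fork (id P₂) (q₁r₂ ∘ fork (id P₂) S)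
      fork-id∘fork-id = ≈.trans (fork∘fork Functional-id) (fork-resp-≈ idˡ ≈.refl)

      stage₁∘α⁻¹ : stage₁ ∘ α⁻¹ P₂ T C ≈ α⁻¹ P₂ T C ∘ fork (id P₂) q₁r₂
      stage₁∘α⁻¹ = ≈.trans (pullʳ (pullʳ (pullʳ (pullʳ α∘α⁻¹)))) (refl⟩∘⟨ refl⟩∘⟨ refl⟩∘⟨ idʳ)

    q-isProcessing : IsProcessing P₂ S s₂ q
    q-isProcessing = q-isSimulator , q-bounded , q-processes

mainTheorem12 : ∀ {o ℓ e p : Level} (𝒞 : TargetContext o ℓ e p) →
    let open Simulators 𝒞 in
    (P P₁ P₂ : Obj)
    (s : Hom (P ⊗₀ C) (T ⊗₀ C)) (s₁ : Hom (P₁ ⊗₀ C) (T ⊗₀ C))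
    (s₂ : Hom (P₂ ⊗₀ C) (T ⊗₀ C)) →
    IsSimulator P s → IsSimulator P₁ s₁ → IsSimulator P₂ s₂ →
    (r₁ : Hom P₁ P) (q₁ : Hom ((P₁ ⊗₀ T) ⊗₀ C) (T ⊗₀ C)) →
    (r₂ : Hom P₂ P₁) (q₂ : Hom ((P₂ ⊗₀ T) ⊗₀ C) (T ⊗₀ C)) →
    IsSimulatorMorphism P P₁ s s₁ r₁ q₁ →
    IsSimulatorMorphism P₁ P₂ s₁ s₂ r₂ q₂ →
    IsReduction s (r₁ ∘ r₂)
    × IsProcessing P₂ (s ∘ ((r₁ ∘ r₂) ⊗₁ id C)) s₂ (compProcessing P₁ P₂ r₂ q₁ q₂)
    × IsSimulatorMorphism P P₂ s s₂ (r₁ ∘ r₂) (compProcessing P₁ P₂ r₂ q₁ q₂)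
mainTheorem12 𝒞 P P₁ P₂ s s₁ s₂ _ _ _ r₁ q₁ r₂ q₂
  (r₁-functional , (a₁ , c₁ , a₁-functional , q₁-fork , q₁-del , _) , q₁-bounded , s₁-processed)
  (r₂-functional , (a₂ , c₂ , a₂-functional , q₂-fork , q₂-del , q₂-context) , q₂-bounded , s₂-processed) =
  r₁r₂-functional , processing , r₁r₂-functional , processing
  where
  open Simulators 𝒞
  open Comonoids gs using (Functional-∘)
  open Composition 𝒞 using (module Composite)

  r₁r₂-functional : Functional (r₁ ∘ r₂)
  r₁r₂-functional = Functional-∘ r₁-functional r₂-functional

  processing : IsProcessing P₂ (s ∘ ((r₁ ∘ r₂) ⊗₁ id C)) s₂ (compProcessing P₁ P₂ r₂ q₁ q₂)
  processing = Composite.q-isProcessing s s₁ s₂ r₁ r₂ r₂-functional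
    q₁ a₁ c₁ a₁-functional q₁-fork q₁-del q₁-bounded s₁-processed
    q₂ a₂ c₂ a₂-functional q₂-fork q₂-del q₂-context q₂-bounded s₂-processed
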